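{- Let $r\ge 5$, let $\zeta=e^{2\pi i/2^r}$ be a primitive $2^r$-th root of unity, let $\mathbb{K}=\mathbb{Q}(\zeta+\zeta^{ -1})$, $n=[\mathbb{K}:\mathbb{Q}]=2^{r-2}$, and let $\mathcal{O}_{\mathbb{K}}=\mathbb{Z}[\zeta+\zeta^{ -1}]$ be its ring of integers. Let $$\alpha=4+(\zeta+\zeta^{ -1})-2(\zeta^{2}+\zeta^{ -2})-(\zeta^{3}+\zeta^{ -3}).$$ Then the lattice $\frac{1}{\sqrt{2^{r-1}}}\sigma_{\alpha}(\mathcal{O}_{\mathbb{K}})\subseteq\mathbb{R}^{2^{r-2}}$ is a rotated $D_n$-lattice.
   Context: $\mathbb{K}$ is totally real with real embeddings $\sigma_1,\dots,\sigma_n:\mathbb{K}\to\mathbb{R}$. For $\alpha\in\mathbb{K}$ with $\sigma_i(\alpha)>0$ for all $i$, the twisted embedding is $\sigma_\alpha:\mathbb{K}\to\mathbb{R}^n$, $x\mapsto(\sqrt{\sigma_1(\alpha)}\sigma_1(x),\dots,\sqrt{\sigma_n(\alpha)}\sigma_n(x))$; the image of a rank-$n$ free $\mathbb{Z}$-submodule of $\mathbb{K}$ is a lattice in $\mathbb{R}^n$. $D_n=\{x\in\mathbb{Z}^n:\ x_1+\cdots+x_n\equiv 0 \pmod 2\}$. A lattice is a rotated $D_n$-lattice if it is the image of $D_n$ under an orthogonal linear map of $\mathbb{R}^n$ (equivalently, it has a Gram matrix equal to a Gram matrix of $D_n$). -}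

module Defs where

open import Data.Nat as ℕ using (ℕ; zero; suc; _∸_; _^_; _≡ᵇ_)
open import Data.Nat.Properties using (m^n≢0)
open import Data.Nat.DivMod using (_%_)
open import Data.Integer as ℤ using (ℤ; +_; -_; 0ℤ; 1ℤ)
open import Data.Integer.Divisibility using (_∣_)
open import Data.Fin using (Fin; toℕ) renaming (zero to fz; suc to fs)
open import Data.Bool using (if_then_else_)
open import Data.Product using (Σ; _×_)
open import Relation.Binary.PropositionalEquality using (_≡_)

sumF : (m : ℕ) → (Fin m → ℤ) → ℤ
sumF zero    f = 0ℤ
sumF (suc m) f = f fz ℤ.+ sumF m (λ i → f (fs i))

-- The cyclotomic ring Z[ζ], ζ = e^{2πi/2^r}, modelled as
-- Z[x]/(x^N + 1) with N = 2^(r-1), elements given by their coefficient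
-- vectors on the power basis 1, ζ, ..., ζ^(N-1).

Nr : ℕ → ℕ
Nr r = 2 ^ (r ∸ 1)

nr : ℕ → ℕ
nr r = 2 ^ (r ∸ 2)

Cyc : ℕ → Set
Cyc r = Fin (Nr r) → ℤ

-- ζ^e  (uses ζ^(2^r) = 1 and ζ^N = -1)
ζpow : (r : ℕ) → ℕ → Cyc r
ζpow r e m =
  let e' = _%_ e (2 ^ r) {{m^n≢0 2 r}} in
  if toℕ m ≡ᵇ e' then 1ℤ
  else if (toℕ m ℕ.+ Nr r) ≡ᵇ e' then - 1ℤ
  else 0ℤ

one : (r : ℕ) → Cyc r
one r = ζpow r 0

add : (r : ℕ) → Cyc r → Cyc r → Cyc r
add r a b m = a m ℤ.+ b m

scal : (r : ℕ) → ℤ → Cyc r → Cyc r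
scal r c a m = c ℤ.* a m

mul : (r : ℕ) → Cyc r → Cyc r → Cyc r
mul r a b m = sumF (Nr r) (λ i → sumF (Nr r) (λ j →
  (a i ℤ.* b j) ℤ.* ζpow r (toℕ i ℕ.+ toℕ j) m))

gal : (r : ℕ) → ℕ → Cyc r → Cyc r
gal r k a m = sumF (Nr r) (λ i → a i ℤ.* ζpow r (k ℕ.* toℕ i) m)

θ : (r : ℕ) → ℕ → Cyc r
θ r k = add r (ζpow r k) (ζpow r (2 ^ r ∸ k))

-- Z-basis of O_K = Z[ζ + ζ^-1]:  b_0 = 1,  b_j = ζ^j + ζ^-j (1 ≤ j < n).
basisO : (r : ℕ) → Fin (nr r) → Cyc r
basisO r j = if toℕ j ≡ᵇ 0 then one r else θ r (toℕ j)

αr : (r : ℕ) → Cyc r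
αr r = add r (scal r (+ 4) (one r))
         (add r (θ r 1) (add r (scal r (- (+ 2)) (θ r 2)) (scal r (- 1ℤ) (θ r 3))))

-- ⟨σ_α(x), σ_α(y)⟩ = Σ_i σ_i(α) σ_i(x) σ_i(y), where the n real embeddings
-- σ_i of K are the restrictions of ζ ↦ ζ^k, k = 1,3,...,N-1 (= 2t+1, t < n).
-- Computed exactly inside Z[ζ] (the result is a rational integer).
twInner : (r : ℕ) → Cyc r → Cyc r → Cyc r
twInner r x y m =
  sumF (nr r) (λ t → gal r (suc (2 ℕ.* toℕ t)) (mul r (αr r) (mul r x y)) m)

InD : (n : ℕ) → (Fin n → ℤ) → Set
InD n v = (+ 2) ∣ sumF n v

dot : (n : ℕ) → (Fin n → ℤ) → (Fin n → ℤ) → ℤ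
dot n u v = sumF n (λ i → u i ℤ.* v i)

IsBasisD : (n : ℕ) → (Fin n → Fin n → ℤ) → Set
IsBasisD n f =
  ((j : Fin n) → InD n (f j)) ×
  (((v : Fin n → ℤ) → InD n v →
     Σ (Fin n → ℤ) (λ c → (i : Fin n) → v i ≡ sumF n (λ j → c j ℤ.* f j i))) ×
   ((c : Fin n → ℤ) → ((i : Fin n) → sumF n (λ j → c j ℤ.* f j i) ≡ 0ℤ) →
     (j : Fin n) → c j ≡ 0ℤ))

-- The lattice (1/√(2^(r-1))) σ_α(O_K) is a rotated D_n-lattice:
-- its Gram matrix in the basis σ_α(b_j)/√(2^(r-1)) equals the Gram matrix
-- of D_n in some Z-basis f of D_n, i.e.
--   ⟨σ_α b_j, σ_α b_k⟩ = 2^(r-1) · ⟨f_j, f_k⟩.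
RotatedD : (r : ℕ) → Set
RotatedD r =
  Σ (Fin (nr r) → Fin (nr r) → ℤ) (λ f →
    IsBasisD (nr r) f ×
    ((j k : Fin (nr r)) (m : Fin (Nr r)) →
      twInner r (basisO r j) (basisO r k) m
        ≡ ((+ (2 ^ (r ∸ 1))) ℤ.* dot (nr r) (f j) (f k)) ℤ.* one r m))

module Submission where

open import Defs
open import Data.Nat using (ℕ; _≤_)
open import Data.Nat as N using (zero; suc; _∸_; _^_; z≤n; s≤s; _<_)
import Data.Nat.Properties as NP
open import Data.Nat.DivMod using (_%_)
import Data.Nat.DivMod as DM
open import Data.Nat.Divisibility using (divides)
open import Data.Nat.Tactic.RingSolver using () renaming (solve-∀ to solveℕ)
open import Data.Integer as Z using (ℤ; +_; -_; 0ℤ; 1ℤ)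
import Data.Integer.Properties as ZP
open import Data.Integer.Divisibility using (_∣_)
open import Data.Integer.Tactic.RingSolver using (solve-∀)
open import Data.Fin using (Fin; toℕ; fromℕ<) renaming (zero to fz; suc to fs)
open import Data.Fin.Properties using (toℕ<n; fromℕ<-toℕ; toℕ-fromℕ<)
open import Data.Bool using (true; false; if_then_else_; T)
open import Data.Product using (Σ; _×_; _,_; proj₁; proj₂)
open import Data.Sum using (_⊎_; inj₁; inj₂)
open import Data.List using (List; []; _∷_; _++_)
open import Data.List.Properties using (++-assoc)
open import Data.List.Relation.Unary.All using (All; []; _∷_) renaming (map to All-map)
open import Data.List.Relation.Unary.All.Properties using (++⁺)
open import Data.Empty using (⊥; ⊥-elim)
open import Relation.Nullary using (¬_; yes; no)
open import Relation.Binary.PropositionalEquality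

-- We exhibit an explicit Z-basis f_0, …, f_(n-1) of D_n and prove
--   Tr(α b_j b_k) = N ⟨f_j, f_k⟩,
-- i.e. σ_α(O_K)/√N and D_n have the same Gram matrix.
--
-- With θ_a θ_b = θ_(a+b) + θ_|a-b| and
--   the character sum Σ_(k odd, k < 2N) ζ^(ks) = N·([s ≡ 0] − [s ≡ N]) (mod 2N)
--   the twisted inner product of b_j, b_k becomes N·traceθ(α θ_j θ_k).
-- * DnBasis: f_0 = −e_0−e_1, f_1 = −e_1−e_2, f_j = e_(j-2)+e_(j-1)−e_j−e_(j+1)
--   for 2 ≤ j ≤ n−2 and f_(n-1) = e_(n-3)+e_(n-2)−2e_(n-1) form a Z-basis of D_n.
-- * GramMatch: αθ(x) = traceθ(α θ_x) equals 4, 1, −2, −1 for x = 0, …, 3,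
--   vanishes for 4 ≤ x ≤ N−4 and equals 1, 2 at x = N−3, N−2; comparing
--   entry by entry gives traceθ(α b_j b_k) = ⟨f_j, f_k⟩.

-- Sum of f 0, …, f (m−1); all index bookkeeping is done on ℕ and only
-- translated to the Fin-indexed sums of Defs at the interfaces.
sumN : ℕ → (ℕ → ℤ) → ℤ
sumN zero f = 0ℤ
sumN (suc m) f = f 0 Z.+ sumN m (λ i → f (suc i))

sumF≡sumN : ∀ n (f : Fin n → ℤ) (g : ℕ → ℤ) → (∀ i → f i ≡ g (toℕ i)) → sumF n f ≡ sumN n g
sumF≡sumN zero f g h = refl
sumF≡sumN (suc n) f g h = cong₂ Z._+_ (h fz) (sumF≡sumN n (λ i → f (fs i)) (λ i → g (suc i)) (λ i → h (fs i)))

sumN-cong : ∀ n {f g : ℕ → ℤ} → (∀ i → i < n → f i ≡ g i) → sumN n f ≡ sumN n g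
sumN-cong zero h = refl
sumN-cong (suc n) h = cong₂ Z._+_ (h 0 (s≤s z≤n)) (sumN-cong n (λ i i<n → h (suc i) (s≤s i<n)))

sumN-+ : ∀ n (f g : ℕ → ℤ) → sumN n (λ i → f i Z.+ g i) ≡ sumN n f Z.+ sumN n g
sumN-+ zero f g = refl
sumN-+ (suc n) f g rewrite sumN-+ n (λ i → f (suc i)) (λ i → g (suc i)) =
  lem (f 0) (g 0) (sumN n (λ i → f (suc i))) (sumN n (λ i → g (suc i)))
  where
  lem : ∀ a b c d → a Z.+ b Z.+ (c Z.+ d) ≡ a Z.+ c Z.+ (b Z.+ d)
  lem = solve-∀

sumN-*ˡ : ∀ n c (f : ℕ → ℤ) → sumN n (λ i → c Z.* f i) ≡ c Z.* sumN n f
sumN-*ˡ zero c f = sym (ZP.*-zeroʳ c)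
sumN-*ˡ (suc n) c f rewrite sumN-*ˡ n c (λ i → f (suc i)) = sym (ZP.*-distribˡ-+ c (f 0) _)

sumN-neg : ∀ k f → sumN k (λ t → - f t) ≡ - sumN k f
sumN-neg zero f = refl
sumN-neg (suc k) f = trans (cong (λ x → - f 0 Z.+ x) (sumN-neg k (λ t → f (suc t))))
                            (sym (ZP.neg-distrib-+ (f 0) _))

sumN-0 : ∀ n → sumN n (λ _ → 0ℤ) ≡ 0ℤ
sumN-0 zero = refl
sumN-0 (suc n) = trans (ZP.+-identityˡ _) (sumN-0 n)

sumN-const : ∀ k c → sumN k (λ _ → c) ≡ + k Z.* c
sumN-const zero c = sym (ZP.*-zeroˡ c)
sumN-const (suc k) c = trans (cong (λ x → c Z.+ x) (sumN-const k c)) (lem c (+ k))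
  where
  lem : ∀ c k → c Z.+ k Z.* c ≡ (1ℤ Z.+ k) Z.* c
  lem = solve-∀

sumN-split : ∀ a b (f : ℕ → ℤ) → sumN (a N.+ b) f ≡ sumN a f Z.+ sumN b (λ t → f (a N.+ t))
sumN-split zero b f = sym (ZP.+-identityˡ _)
sumN-split (suc a) b f rewrite sumN-split a b (λ i → f (suc i)) = sym (ZP.+-assoc (f 0) _ _)

sumN-snoc : ∀ k (g : ℕ → ℤ) → sumN (suc k) g ≡ sumN k g Z.+ g k
sumN-snoc zero g = trans (ZP.+-identityʳ (g 0)) (sym (ZP.+-identityˡ (g 0)))
sumN-snoc (suc k) g = trans (cong (λ x → g 0 Z.+ x) (sumN-snoc k (λ i → g (suc i)))) (sym (ZP.+-assoc (g 0) _ _))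

sumN-rev : ∀ k (g : ℕ → ℤ) → sumN k g ≡ sumN k (λ t → g (k ∸ suc t))
sumN-rev zero g = refl
sumN-rev (suc k) g = trans (sumN-snoc k g) (trans (ZP.+-comm _ (g k)) (cong (λ x → g k Z.+ x) (sumN-rev k g)))

-- Kronecker delta on ℕ, written with the boolean test used in Defs so that it
-- computes on numerals.
δ : ℕ → ℕ → ℤ
δ a b = if a N.≡ᵇ b then 1ℤ else 0ℤ

≡ᵇ-refl : ∀ a → (a N.≡ᵇ a) ≡ true
≡ᵇ-refl zero = refl
≡ᵇ-refl (suc a) = ≡ᵇ-refl a

≡ᵇ-≢ : ∀ {a b} → ¬ a ≡ b → (a N.≡ᵇ b) ≡ false
≡ᵇ-≢ {zero} {zero} h = ⊥-elim (h refl)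
≡ᵇ-≢ {zero} {suc b} h = refl
≡ᵇ-≢ {suc a} {zero} h = refl
≡ᵇ-≢ {suc a} {suc b} h = ≡ᵇ-≢ {a} {b} (λ e → h (cong suc e))

≡ᵇ-+ʳ : ∀ k a b → ((a N.+ k) N.≡ᵇ (b N.+ k)) ≡ (a N.≡ᵇ b)
≡ᵇ-+ʳ k a b with a N.≟ b
... | yes refl = trans (≡ᵇ-refl (a N.+ k)) (sym (≡ᵇ-refl a))
... | no ne = trans (≡ᵇ-≢ (λ e → ne (NP.+-cancelʳ-≡ k a b e))) (sym (≡ᵇ-≢ ne))

δ-refl : ∀ a → δ a a ≡ 1ℤ
δ-refl a rewrite ≡ᵇ-refl a = refl

δ-≢ : ∀ {a b} → ¬ a ≡ b → δ a b ≡ 0ℤ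
δ-≢ h rewrite ≡ᵇ-≢ h = refl

δ-sym : ∀ a b → δ a b ≡ δ b a
δ-sym a b with a N.≟ b
... | yes refl = refl
... | no ne = trans (δ-≢ ne) (sym (δ-≢ (λ e → ne (sym e))))

sumN-δ : ∀ n p (g : ℕ → ℤ) → p < n → sumN n (λ i → δ i p Z.* g i) ≡ g p
sumN-δ (suc n) zero g _ =
  trans (cong₂ Z._+_ (ZP.*-identityˡ (g 0))
           (trans (sumN-cong n (λ i _ → ZP.*-zeroˡ (g (suc i)))) (sumN-0 n)))
        (ZP.+-identityʳ _)
sumN-δ (suc n) (suc p) g (s≤s p<n) =
  trans (cong₂ Z._+_ (ZP.*-zeroˡ (g 0)) (sumN-δ n p (λ i → g (suc i)) p<n))
        (ZP.+-identityˡ _)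

module Cyclotomic (q : ℕ) where

  -- Throughout r = q + 2: n = 2^q = [K : Q], N = Nn = 2^(q+1) is the number of
  -- coefficients of Z[ζ] = Z[x]/(x^N + 1), and M = 2^(q+2) is the order of ζ.
  n : ℕ
  n = 2 ^ q
  Nn : ℕ
  Nn = 2 ^ suc q
  M : ℕ
  M = 2 ^ suc (suc q)

  instance
    nzM : N.NonZero M
    nzM = NP.m^n≢0 2 (suc (suc q))

  M≡N+N : M ≡ Nn N.+ Nn
  M≡N+N = cong (Nn N.+_) (NP.+-identityʳ Nn)

  N>0 : 0 < Nn
  N>0 = NP.m^n>0 2 (suc q)

  N<M : Nn < M
  N<M = subst (Nn <_) (sym M≡N+N) (NP.m<m+n Nn N>0)

  -- Coefficient vector of ζ^e for a reduced exponent e < M: ζ^e = −ζ^(e−N) when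
  -- N ≤ e.  This is the definition of ζpow in Defs, read on ℕ-indices.
  monoRed : ℕ → ℕ → ℤ
  monoRed e' i = if i N.≡ᵇ e' then 1ℤ else if (i N.+ Nn) N.≡ᵇ e' then - 1ℤ else 0ℤ

  mono : ℕ → ℕ → ℤ
  mono e i = monoRed (e % M) i

  monoRed-lo : ∀ {p i} → p < Nn → monoRed p i ≡ δ i p
  monoRed-lo {p} {i} p<N with i N.≡ᵇ p
  ... | true = refl
  ... | false rewrite ≡ᵇ-≢ {i N.+ Nn} {p} (λ e → NP.<⇒≢ (NP.<-≤-trans p<N (NP.m≤n+m Nn i)) (sym e)) = refl

  monoRed-hi : ∀ {p i} → i < Nn → monoRed (p N.+ Nn) i ≡ - δ i p
  monoRed-hi {p} {i} i<N
    rewrite ≡ᵇ-≢ {i} {p N.+ Nn} (λ e → NP.<⇒≢ (NP.<-≤-trans i<N (NP.m≤n+m Nn p)) e)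
          | ≡ᵇ-+ʳ Nn i p with i N.≡ᵇ p
  ... | true = refl
  ... | false = refl

  data Residue (e : ℕ) : Set where
    lo : ∀ p → p < Nn → e % M ≡ p → Residue e
    hi : ∀ p → p < Nn → e % M ≡ p N.+ Nn → Residue e

  residue : ∀ e → Residue e
  residue e with e % M N.<? Nn
  ... | yes lt = lo (e % M) lt refl
  ... | no ge = hi (e % M ∸ Nn) lt (sym (NP.m∸n+n≡m (NP.≮⇒≥ ge)))
    where
    lt : e % M ∸ Nn < Nn
    lt = NP.+-cancelʳ-< Nn (e % M ∸ Nn) Nn
           (subst (λ x → x < Nn N.+ Nn) (sym (NP.m∸n+n≡m (NP.≮⇒≥ ge)))
             (subst (e % M <_) M≡N+N (DM.m%n<n e M)))

  resExp : ∀ {e} → Residue e → ℕ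
  resExp (lo p _ _) = p
  resExp (hi p _ _) = p

  resSign : ∀ {e} → Residue e → ℤ
  resSign (lo _ _ _) = 1ℤ
  resSign (hi _ _ _) = - 1ℤ

  resExp<N : ∀ {e} (v : Residue e) → resExp v < Nn
  resExp<N (lo p l _) = l
  resExp<N (hi p l _) = l

  mono-δ : ∀ e i → i < Nn → mono e i ≡ resSign (residue e) Z.* δ i (resExp (residue e))
  mono-δ e i i<N with residue e
  ... | lo p l eq = trans (cong (λ x → monoRed x i) eq) (trans (monoRed-lo {p} {i} l) (sym (ZP.*-identityˡ _)))
  ... | hi p l eq = trans (cong (λ x → monoRed x i) eq) (trans (monoRed-hi {p} {i} i<N) (sym (ZP.-1*i≡-i _)))

  mono-mod : ∀ {a b} → a % M ≡ b % M → ∀ i → mono a i ≡ mono b i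
  mono-mod eq i = cong (λ x → monoRed x i) eq

  modL : ∀ a b → (a N.+ b) % M ≡ (a % M N.+ b) % M
  modL a b = trans (DM.%-distribˡ-+ a b M)
               (trans (cong (λ x → (x N.+ b % M) % M) (sym (DM.m%n%n≡m%n a M)))
                      (sym (DM.%-distribˡ-+ (a % M) b M)))

  N%M : Nn % M ≡ Nn
  N%M = DM.m<n⇒m%n≡m N<M

  mono-N : ∀ e i → i < Nn → mono (e N.+ Nn) i ≡ - mono e i
  mono-N e i i<N with residue e
  ... | lo p l eq =
    trans (cong (λ x → monoRed x i) e1) (trans (monoRed-hi {p} {i} i<N)
      (cong -_ (sym (trans (cong (λ x → monoRed x i) eq) (monoRed-lo {p} {i} l)))))
    where
    e1 : (e N.+ Nn) % M ≡ p N.+ Nn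
    e1 = trans (modL e Nn) (trans (cong (λ x → (x N.+ Nn) % M) eq)
           (DM.m<n⇒m%n≡m (subst (p N.+ Nn <_) (sym M≡N+N) (NP.+-monoˡ-< Nn l))))
  ... | hi p l eq =
    trans (cong (λ x → monoRed x i) e1) (trans (monoRed-lo {p} {i} l)
      (trans (sym (ZP.neg-involutive _))
      (cong -_ (sym (trans (cong (λ x → monoRed x i) eq) (monoRed-hi {p} {i} i<N))))))
    where
    e1 : (e N.+ Nn) % M ≡ p
    e1 = trans (modL e Nn) (trans (cong (λ x → (x N.+ Nn) % M) eq)
           (trans (cong (_% M) (trans (NP.+-assoc p Nn Nn) (cong (p N.+_) (sym M≡N+N))))
           (trans (DM.[m+n]%n≡m%n p M) (DM.m<n⇒m%n≡m (NP.<-trans l N<M)))))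

  mono-shift : ∀ x f i → i < Nn → mono (x N.+ f) i ≡ resSign (residue x) Z.* mono (resExp (residue x) N.+ f) i
  mono-shift x f i i<N with residue x
  ... | lo p l eq = trans (mono-mod (trans (modL x f) (cong (λ y → (y N.+ f) % M) eq)) i)
                      (sym (ZP.*-identityˡ _))
  ... | hi p l eq =
    trans (mono-mod (trans (modL x f) (trans (cong (λ y → (y N.+ f) % M) eq)
                   (cong (_% M) (ar p Nn f)))) i)
      (trans (mono-N (p N.+ f) i i<N) (sym (ZP.-1*i≡-i _)))
    where
    ar : ∀ a b c → a N.+ b N.+ c ≡ a N.+ c N.+ b
    ar a b c = trans (NP.+-assoc a b c) (trans (cong (a N.+_) (NP.+-comm b c)) (sym (NP.+-assoc a c b)))

  sumN-mono : ∀ e (g : ℕ → ℤ) → sumN Nn (λ i → mono e i Z.* g i) ≡ resSign (residue e) Z.* g (resExp (residue e))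
  sumN-mono e g =
    trans (sumN-cong Nn (λ i i<N → trans (cong (Z._* g i) (mono-δ e i i<N)) (ZP.*-assoc (resSign (residue e)) _ _)))
      (trans (sumN-*ˡ Nn (resSign (residue e)) (λ i → δ i (resExp (residue e)) Z.* g i))
        (cong (resSign (residue e) Z.*_) (sumN-δ Nn (resExp (residue e)) g (resExp<N (residue e)))))

  mulCoeff : (ℕ → ℤ) → (ℕ → ℤ) → ℕ → ℤ
  mulCoeff u v m = sumN Nn (λ i → sumN Nn (λ j → (u i Z.* v j) Z.* mono (i N.+ j) m))

  mulCoeff-mono : ∀ x y m → m < Nn → mulCoeff (mono x) (mono y) m ≡ mono (x N.+ y) m
  mulCoeff-mono x y m m<N =
    trans (sumN-cong Nn (λ i _ → inner i))
     (trans (sumN-*ˡ Nn (resSign (residue y)) (λ i → mono x i Z.* mono (i N.+ resExp (residue y)) m))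
      (trans (cong (resSign (residue y) Z.*_) (sumN-mono x (λ i → mono (i N.+ resExp (residue y)) m)))
       (sym rhs)))
    where
    inner : ∀ i → sumN Nn (λ j → (mono x i Z.* mono y j) Z.* mono (i N.+ j) m)
                 ≡ resSign (residue y) Z.* (mono x i Z.* mono (i N.+ resExp (residue y)) m)
    inner i = trans (sumN-cong Nn (λ j _ → lem (mono x i) (mono y j) (mono (i N.+ j) m)))
                    (sumN-mono y (λ j → mono x i Z.* mono (i N.+ j) m))
      where
      lem : ∀ a b c → (a Z.* b) Z.* c ≡ b Z.* (a Z.* c)
      lem = solve-∀
    rhs : mono (x N.+ y) m ≡ resSign (residue y) Z.* (resSign (residue x) Z.* mono (resExp (residue x) N.+ resExp (residue y)) m)
    rhs = trans (mono-shift x y m m<N)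
           (trans (cong (resSign (residue x) Z.*_) (trans (cong (λ z → mono z m) (NP.+-comm (resExp (residue x)) y))
                 (trans (mono-shift y (resExp (residue x)) m m<N)
                   (cong (λ z → resSign (residue y) Z.* mono z m) (NP.+-comm (resExp (residue y)) (resExp (residue x)))))))
            (lem (resSign (residue x)) (resSign (residue y)) _))
      where
      lem : ∀ a b c → a Z.* (b Z.* c) ≡ b Z.* (a Z.* c)
      lem = solve-∀


  -- Formal integer combinations Σ c ζ^e of powers of ζ, and their coefficient vectors.
  Terms : Set
  Terms = List (ℤ × ℕ)

  eval : Terms → ℕ → ℤ
  eval [] i = 0ℤ
  eval ((c , e) ∷ L) i = c Z.* mono e i Z.+ eval L i

  eval-++ : ∀ L L' i → eval (L ++ L') i ≡ eval L i Z.+ eval L' i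
  eval-++ [] L' i = sym (ZP.+-identityˡ _)
  eval-++ ((c , e) ∷ L) L' i rewrite eval-++ L L' i = sym (ZP.+-assoc (c Z.* mono e i) (eval L i) (eval L' i))

  _⊗₁_ : ℤ × ℕ → Terms → Terms
  t ⊗₁ [] = []
  (c , e) ⊗₁ ((c' , e') ∷ L) = (c Z.* c' , e N.+ e') ∷ ((c , e) ⊗₁ L)

  _⊗_ : Terms → Terms → Terms
  [] ⊗ L' = []
  (t ∷ L) ⊗ L' = (t ⊗₁ L') ++ (L ⊗ L')

  mulCoeff-linˡ : ∀ c u u' v m → mulCoeff (λ i → c Z.* u i Z.+ u' i) v m ≡ c Z.* mulCoeff u v m Z.+ mulCoeff u' v m
  mulCoeff-linˡ c u u' v m =
    trans (sumN-cong Nn (λ i _ →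
       trans (sumN-cong Nn (λ j _ → lem c (u i) (u' i) (v j) (mono (i N.+ j) m)))
        (trans (sumN-+ Nn _ _) (cong (Z._+ _) (sumN-*ˡ Nn c _)))))
      (trans (sumN-+ Nn _ _) (cong (Z._+ _) (sumN-*ˡ Nn c _)))
    where
    lem : ∀ c a a' b z → ((c Z.* a Z.+ a') Z.* b) Z.* z ≡ c Z.* ((a Z.* b) Z.* z) Z.+ (a' Z.* b) Z.* z
    lem = solve-∀

  mulCoeff-linʳ : ∀ c u v v' m → mulCoeff u (λ j → c Z.* v j Z.+ v' j) m ≡ c Z.* mulCoeff u v m Z.+ mulCoeff u v' m
  mulCoeff-linʳ c u v v' m =
    trans (sumN-cong Nn (λ i _ →
       trans (sumN-cong Nn (λ j _ → lem c (u i) (v j) (v' j) (mono (i N.+ j) m)))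
        (trans (sumN-+ Nn _ _) (cong (Z._+ _) (sumN-*ˡ Nn c _)))))
      (trans (sumN-+ Nn _ _) (cong (Z._+ _) (sumN-*ˡ Nn c _)))
    where
    lem : ∀ c a b b' z → (a Z.* (c Z.* b Z.+ b')) Z.* z ≡ c Z.* ((a Z.* b) Z.* z) Z.+ (a Z.* b') Z.* z
    lem = solve-∀

  mulCoeff-0ˡ : ∀ v m → mulCoeff (λ _ → 0ℤ) v m ≡ 0ℤ
  mulCoeff-0ˡ v m = trans (sumN-cong Nn (λ i _ → trans (sumN-cong Nn (λ j _ → ZP.*-zeroˡ (mono (i N.+ j) m))) (sumN-0 Nn))) (sumN-0 Nn)

  mulCoeff-0ʳ : ∀ u m → mulCoeff u (λ _ → 0ℤ) m ≡ 0ℤ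
  mulCoeff-0ʳ u m = trans (sumN-cong Nn (λ i _ → trans (sumN-cong Nn (λ j _ →
                 trans (cong (Z._* mono (i N.+ j) m) (ZP.*-zeroʳ (u i))) (ZP.*-zeroˡ (mono (i N.+ j) m)))) (sumN-0 Nn))) (sumN-0 Nn)

  mulCoeff-eval₁ : ∀ c e L' m → m < Nn → c Z.* mulCoeff (mono e) (eval L') m ≡ eval ((c , e) ⊗₁ L') m
  mulCoeff-eval₁ c e [] m m<N = trans (cong (c Z.*_) (mulCoeff-0ʳ (mono e) m)) (ZP.*-zeroʳ c)
  mulCoeff-eval₁ c e ((c' , e') ∷ L') m m<N =
    trans (cong (c Z.*_) (mulCoeff-linʳ c' (mono e) (mono e') (eval L') m))
     (trans (cong (λ z → c Z.* (c' Z.* z Z.+ mulCoeff (mono e) (eval L') m)) (mulCoeff-mono e e' m m<N))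
      (trans (ZP.*-distribˡ-+ c _ _)
        (cong₂ Z._+_ (sym (ZP.*-assoc c c' _)) (mulCoeff-eval₁ c e L' m m<N))))

  mulCoeff-eval : ∀ L L' m → m < Nn → mulCoeff (eval L) (eval L') m ≡ eval (L ⊗ L') m
  mulCoeff-eval [] L' m m<N = mulCoeff-0ˡ (eval L') m
  mulCoeff-eval ((c , e) ∷ L) L' m m<N =
    trans (mulCoeff-linˡ c (mono e) (eval L) (eval L') m)
      (trans (cong₂ Z._+_ (mulCoeff-eval₁ c e L' m m<N) (mulCoeff-eval L L' m m<N))
        (sym (eval-++ ((c , e) ⊗₁ L') (L ⊗ L') m)))

  r : ℕ
  r = suc (suc q)

  mul-eval : ∀ (a b : Fin Nn → ℤ) L L' → (∀ i → a i ≡ eval L (toℕ i)) → (∀ i → b i ≡ eval L' (toℕ i)) →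
           ∀ m → mul r a b m ≡ eval (L ⊗ L') (toℕ m)
  mul-eval a b L L' ha hb m =
    trans (sumF≡sumN Nn _ (λ i → sumN Nn (λ j → (eval L i Z.* eval L' j) Z.* mono (i N.+ j) (toℕ m)))
            (λ i → sumF≡sumN Nn _ _ (λ j → cong (λ z → z Z.* mono (toℕ i N.+ toℕ j) (toℕ m))
                     (cong₂ Z._*_ (ha i) (hb j)))))
      (mulCoeff-eval L L' (toℕ m) (toℕ<n m))


  scaleExps : ℕ → Terms → Terms
  scaleExps k [] = []
  scaleExps k ((c , e) ∷ L) = (c , k N.* e) ∷ scaleExps k L

  galCoeff : (ℕ → ℤ) → ℕ → ℕ → ℤ
  galCoeff u k m = sumN Nn (λ i → u i Z.* mono (k N.* i) m)

  kmodL : ∀ k x → (k N.* x) % M ≡ (k N.* (x % M)) % M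
  kmodL k x = trans (DM.%-distribˡ-* k x M)
                (trans (cong (λ z → (k % M N.* z) % M) (sym (DM.m%n%n≡m%n x M)))
                       (sym (DM.%-distribˡ-* k (x % M) M)))

  -- For odd k, (± ζ^p)^k = ± ζ^(kp) with the same sign, because k·N ≡ N (mod M).
  mono-odd : ∀ w x m → m < Nn → mono (suc (2 N.* w) N.* x) m ≡ resSign (residue x) Z.* mono (suc (2 N.* w) N.* resExp (residue x)) m
  mono-odd w x m m<N with residue x
  ... | lo p l eq = trans (mono-mod (trans (kmodL (suc (2 N.* w)) x) (cong (λ z → (suc (2 N.* w) N.* z) % M) eq)) m)
                      (sym (ZP.*-identityˡ _))
  ... | hi p l eq =
    trans (mono-mod (trans (kmodL k x) (trans (cong (λ z → (k N.* z) % M) eq)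
             (trans (cong (_% M) (ar w p Nn)) (DM.[m+kn]%n≡m%n (k N.* p N.+ Nn) w M)))) m)
      (trans (mono-N (k N.* p) m m<N) (sym (ZP.-1*i≡-i _)))
    where
    k : ℕ
    k = suc (2 N.* w)
    ar : ∀ w p N' → suc (2 N.* w) N.* (p N.+ N') ≡ suc (2 N.* w) N.* p N.+ N' N.+ w N.* (2 N.* N')
    ar = solveℕ

  galCoeff-lin : ∀ c u u' k m → galCoeff (λ i → c Z.* u i Z.+ u' i) k m ≡ c Z.* galCoeff u k m Z.+ galCoeff u' k m
  galCoeff-lin c u u' k m =
    trans (sumN-cong Nn (λ i _ → lem c (u i) (u' i) (mono (k N.* i) m)))
      (trans (sumN-+ Nn _ _) (cong (Z._+ _) (sumN-*ˡ Nn c _)))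
    where
    lem : ∀ c a a' z → (c Z.* a Z.+ a') Z.* z ≡ c Z.* (a Z.* z) Z.+ a' Z.* z
    lem = solve-∀

  galCoeff-eval : ∀ w L m → m < Nn → galCoeff (eval L) (suc (2 N.* w)) m ≡ eval (scaleExps (suc (2 N.* w)) L) m
  galCoeff-eval w [] m m<N = trans (sumN-cong Nn (λ i _ → ZP.*-zeroˡ (mono (suc (2 N.* w) N.* i) m))) (sumN-0 Nn)
  galCoeff-eval w ((c , e) ∷ L) m m<N =
    trans (galCoeff-lin c (mono e) (eval L) (suc (2 N.* w)) m)
      (cong₂ Z._+_ (cong (c Z.*_) (trans (sumN-mono e (λ i → mono (suc (2 N.* w) N.* i) m))
                                         (sym (mono-odd w e m m<N))))
                   (galCoeff-eval w L m m<N))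

  gal-eval : ∀ (a : Fin Nn → ℤ) L w → (∀ i → a i ≡ eval L (toℕ i)) →
           ∀ m → gal r (suc (2 N.* w)) a m ≡ eval (scaleExps (suc (2 N.* w)) L) (toℕ m)
  gal-eval a L w ha m =
    trans (sumF≡sumN Nn _ (λ i → eval L i Z.* mono (suc (2 N.* w) N.* i) (toℕ m))
             (λ i → cong (Z._* _) (ha i)))
      (galCoeff-eval w L (toℕ m) (toℕ<n m))


  -- Formal combinations Σ c θ_s of the real elements θ_s = ζ^s + ζ^(M−s) (s ≤ M).
  θTerms : Set
  θTerms = List (ℤ × ℕ)

  expandθ : θTerms → Terms
  expandθ [] = []
  expandθ ((c , s) ∷ L) = (c , s) ∷ (c , M ∸ s) ∷ expandθ L

  evalθ : θTerms → ℕ → ℤ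
  evalθ L = eval (expandθ L)

  _⊖_ : ℕ → ℕ → ℕ
  a ⊖ b = (a ∸ b) N.+ (b ∸ a)

  modeqM : ∀ x y → x ≡ y N.+ M → x % M ≡ y % M
  modeqM x y eq = trans (cong (_% M) eq) (DM.[m+n]%n≡m%n y M)

  -- Exponent identities behind θ_a θ_b = θ_(a+b) + θ_|a−b| when a + b ≤ M: the four
  -- products ζ^(±a) ζ^(±b) have exponents a+b, |a−b|, M−|a−b| and M−(a+b), up to
  -- multiples of M.  First the case b ≤ a, written a = b + d, M = a + b + t.
  facts≥ : ∀ b d t → let a = b N.+ d ; M' = a N.+ b N.+ t in
           (M' ∸ a N.+ (M' ∸ b) ≡ (M' ∸ (a N.+ b)) N.+ M') × (a N.+ (M' ∸ b) ≡ (a ⊖ b) N.+ M') ×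
           (M' ∸ a N.+ b ≡ M' ∸ (a ⊖ b))
  facts≥ b d t = f1 , f2 , f3
    where
    e1 : b N.+ d N.+ b N.+ t ∸ (b N.+ d) ≡ b N.+ t
    e1 = trans (cong (_∸ (b N.+ d)) (NP.+-assoc (b N.+ d) b t)) (NP.m+n∸m≡n (b N.+ d) (b N.+ t))
    e2 : b N.+ d N.+ b N.+ t ∸ b ≡ d N.+ b N.+ t
    e2 = trans (cong (_∸ b) (trans (NP.+-assoc (b N.+ d) b t) (NP.+-assoc b d (b N.+ t))))
          (trans (NP.m+n∸m≡n b (d N.+ (b N.+ t))) (sym (NP.+-assoc d b t)))
    e3 : b N.+ d N.+ b N.+ t ∸ (b N.+ d N.+ b) ≡ t
    e3 = NP.m+n∸m≡n (b N.+ d N.+ b) t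
    e4 : (b N.+ d) ⊖ b ≡ d
    e4 = trans (cong₂ N._+_ (NP.m+n∸m≡n b d) (NP.m≤n⇒m∸n≡0 (NP.m≤m+n b d))) (NP.+-identityʳ d)
    f1 : b N.+ d N.+ b N.+ t ∸ (b N.+ d) N.+ (b N.+ d N.+ b N.+ t ∸ b) ≡ (b N.+ d N.+ b N.+ t ∸ (b N.+ d N.+ b)) N.+ (b N.+ d N.+ b N.+ t)
    f1 rewrite e1 | e2 | e3 = sol b d t
      where
      sol : ∀ b d t → b N.+ t N.+ (d N.+ b N.+ t) ≡ t N.+ (b N.+ d N.+ b N.+ t)
      sol = solveℕ
    f2 : b N.+ d N.+ (b N.+ d N.+ b N.+ t ∸ b) ≡ ((b N.+ d) ⊖ b) N.+ (b N.+ d N.+ b N.+ t)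
    f2 rewrite e2 | e4 = sol b d t
      where
      sol : ∀ b d t → b N.+ d N.+ (d N.+ b N.+ t) ≡ d N.+ (b N.+ d N.+ b N.+ t)
      sol = solveℕ
    f3 : b N.+ d N.+ b N.+ t ∸ (b N.+ d) N.+ b ≡ b N.+ d N.+ b N.+ t ∸ ((b N.+ d) ⊖ b)
    f3 rewrite e1 | e4 = sym (trans (cong (_∸ d) (sol b d t)) (NP.m+n∸m≡n d (b N.+ t N.+ b)))
      where
      sol : ∀ b d t → b N.+ d N.+ b N.+ t ≡ d N.+ (b N.+ t N.+ b)
      sol = solveℕ

  ⊖-comm : ∀ a b → a ⊖ b ≡ b ⊖ a
  ⊖-comm a b = NP.+-comm (a ∸ b) (b ∸ a)

  -- The cross terms ζ^a ζ^(−b), ζ^(−a) ζ^b give θ_|a−b|, with the roles depending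
  -- on which of a, b is larger.
  data PairF (M' a b : ℕ) : Set where
    ge : a N.+ (M' ∸ b) ≡ (a ⊖ b) N.+ M' → M' ∸ a N.+ b ≡ M' ∸ (a ⊖ b) → PairF M' a b
    lt : a N.+ (M' ∸ b) ≡ M' ∸ (a ⊖ b) → M' ∸ a N.+ b ≡ (a ⊖ b) N.+ M' → PairF M' a b

  PF : ℕ → ℕ → ℕ → Set
  PF M' a b = (M' ∸ a N.+ (M' ∸ b) ≡ (M' ∸ (a N.+ b)) N.+ M') × PairF M' a b

  pf-ge : ∀ b d t → PF (b N.+ d N.+ b N.+ t) (b N.+ d) b
  pf-ge b d t = let (f1 , f2 , f3) = facts≥ b d t in f1 , ge f2 f3

  pf-lt : ∀ a d t → PF (a N.+ (a N.+ d) N.+ t) a (a N.+ d)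
  pf-lt a d t = subst (λ X → PF X a A) eM (g1 , lt g2 g3)
    where
    A : ℕ
    A = a N.+ d
    M0 : ℕ
    M0 = a N.+ d N.+ a N.+ t
    eM : M0 ≡ a N.+ A N.+ t
    eM = cong (N._+ t) (NP.+-comm A a)
    f1 : M0 ∸ A N.+ (M0 ∸ a) ≡ (M0 ∸ (A N.+ a)) N.+ M0
    f1 = proj₁ (facts≥ a d t)
    f2 : A N.+ (M0 ∸ a) ≡ (A ⊖ a) N.+ M0
    f2 = proj₁ (proj₂ (facts≥ a d t))
    f3 : M0 ∸ A N.+ a ≡ M0 ∸ (A ⊖ a)
    f3 = proj₂ (proj₂ (facts≥ a d t))
    g1 : M0 ∸ a N.+ (M0 ∸ A) ≡ (M0 ∸ (a N.+ A)) N.+ M0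
    g1 = trans (NP.+-comm (M0 ∸ a) (M0 ∸ A)) (trans f1 (cong (λ Y → (M0 ∸ Y) N.+ M0) (NP.+-comm A a)))
    g2 : a N.+ (M0 ∸ A) ≡ M0 ∸ (a ⊖ A)
    g2 = trans (NP.+-comm a (M0 ∸ A)) (trans f3 (cong (M0 ∸_) (⊖-comm A a)))
    g3 : M0 ∸ a N.+ A ≡ (a ⊖ A) N.+ M0
    g3 = trans (NP.+-comm (M0 ∸ a) A) (trans f2 (cong (N._+ M0) (⊖-comm A a)))

  pf-go₁ : ∀ a b d t M' → a ≡ b N.+ d → a N.+ b N.+ t ≡ M' → PF M' a b
  pf-go₁ _ b d t _ refl refl = pf-ge b d t

  pf-go₂ : ∀ a b d t M' → b ≡ a N.+ d → a N.+ b N.+ t ≡ M' → PF M' a b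
  pf-go₂ a _ d t _ refl refl = pf-lt a d t

  pairFacts₀ : ∀ a b t M' → a N.+ b N.+ t ≡ M' → PF M' a b
  pairFacts₀ a b t M' eq with NP.≤-total b a
  ... | inj₁ b≤a = pf-go₁ a b (a ∸ b) t M' (sym (NP.m+[n∸m]≡n b≤a)) eq
  ... | inj₂ a≤b = pf-go₂ a b (b ∸ a) t M' (sym (NP.m+[n∸m]≡n a≤b)) eq

  pairFacts : ∀ a b → a N.+ b ≤ M → PF M a b
  pairFacts a b le = pairFacts₀ a b (M ∸ (a N.+ b)) M (NP.m+[n∸m]≡n le)

  θ-product : ∀ c c' a b → a N.+ b ≤ M → ∀ i →
    eval (expandθ ((c , a) ∷ []) ⊗ expandθ ((c' , b) ∷ [])) i ≡ evalθ ((c Z.* c' , a N.+ b) ∷ (c Z.* c' , a ⊖ b) ∷ []) i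
  θ-product c c' a b le i with pairFacts a b le
  ... | f1 , ge f2 f3 =
     trans (cong₂ (λ u v → k Z.* z1 Z.+ (k Z.* u Z.+ (k Z.* v Z.+ (k Z.* mono (M ∸ a N.+ (M ∸ b)) i Z.+ 0ℤ))))
               (mono-mod (modeqM _ _ f2) i) (cong (λ e → mono e i) f3))
       (trans (cong (λ u → k Z.* z1 Z.+ (k Z.* mono (a ⊖ b) i Z.+ (k Z.* mono (M ∸ (a ⊖ b)) i Z.+ (k Z.* u Z.+ 0ℤ))))
               (mono-mod (modeqM _ _ f1) i))
         (lem k z1 _ _ _))
    where
    k : ℤ
    k = c Z.* c'
    z1 : ℤ
    z1 = mono (a N.+ b) i
    lem : ∀ k x p q r → k Z.* x Z.+ (k Z.* p Z.+ (k Z.* q Z.+ (k Z.* r Z.+ 0ℤ)))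
                      ≡ k Z.* x Z.+ (k Z.* r Z.+ (k Z.* p Z.+ (k Z.* q Z.+ 0ℤ)))
    lem = solve-∀
  ... | f1 , lt f2 f3 =
     trans (cong₂ (λ u v → k Z.* z1 Z.+ (k Z.* u Z.+ (k Z.* v Z.+ (k Z.* mono (M ∸ a N.+ (M ∸ b)) i Z.+ 0ℤ))))
               (cong (λ e → mono e i) f2) (mono-mod (modeqM _ _ f3) i))
       (trans (cong (λ u → k Z.* z1 Z.+ (k Z.* mono (M ∸ (a ⊖ b)) i Z.+ (k Z.* mono (a ⊖ b) i Z.+ (k Z.* u Z.+ 0ℤ))))
               (mono-mod (modeqM _ _ f1) i))
         (lem k z1 _ _ _))
    where
    k : ℤ
    k = c Z.* c'
    z1 : ℤ
    z1 = mono (a N.+ b) i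
    lem : ∀ k x q p r → k Z.* x Z.+ (k Z.* q Z.+ (k Z.* p Z.+ (k Z.* r Z.+ 0ℤ)))
                      ≡ k Z.* x Z.+ (k Z.* r Z.+ (k Z.* p Z.+ (k Z.* q Z.+ 0ℤ)))
    lem = solve-∀

  _⊛₁_ : ℤ × ℕ → θTerms → θTerms
  x ⊛₁ [] = []
  (c , a) ⊛₁ ((c' , b) ∷ B) = (c Z.* c' , a N.+ b) ∷ (c Z.* c' , a ⊖ b) ∷ ((c , a) ⊛₁ B)

  _⊛_ : θTerms → θTerms → θTerms
  [] ⊛ B = []
  (x ∷ A) ⊛ B = (x ⊛₁ B) ++ (A ⊛ B)

  expandθ-++ : ∀ A B → expandθ (A ++ B) ≡ expandθ A ++ expandθ B
  expandθ-++ [] B = refl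
  expandθ-++ ((c , s) ∷ A) B = cong (λ z → (c , s) ∷ (c , M ∸ s) ∷ z) (expandθ-++ A B)

  ⊗-++ˡ : ∀ L1 L2 L' → (L1 ++ L2) ⊗ L' ≡ (L1 ⊗ L') ++ (L2 ⊗ L')
  ⊗-++ˡ [] L2 L' = refl
  ⊗-++ˡ (t ∷ L1) L2 L' = trans (cong ((t ⊗₁ L') ++_) (⊗-++ˡ L1 L2 L'))
                               (sym (++-assoc (t ⊗₁ L') (L1 ⊗ L') (L2 ⊗ L')))

  ⊗₁-++ : ∀ t L1 L2 → t ⊗₁ (L1 ++ L2) ≡ (t ⊗₁ L1) ++ (t ⊗₁ L2)
  ⊗₁-++ t [] L2 = refl
  ⊗₁-++ (c , e) ((c' , e') ∷ L1) L2 = cong ((c Z.* c' , e N.+ e') ∷_) (⊗₁-++ (c , e) L1 L2)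

  eval-⊗-++ʳ : ∀ L L1 L2 i → eval (L ⊗ (L1 ++ L2)) i ≡ eval (L ⊗ L1) i Z.+ eval (L ⊗ L2) i
  eval-⊗-++ʳ [] L1 L2 i = sym (ZP.+-identityˡ 0ℤ)
  eval-⊗-++ʳ (t ∷ L) L1 L2 i =
    trans (eval-++ (t ⊗₁ (L1 ++ L2)) (L ⊗ (L1 ++ L2)) i)
     (trans (cong₂ Z._+_ (trans (cong (λ z → eval z i) (⊗₁-++ t L1 L2)) (eval-++ (t ⊗₁ L1) (t ⊗₁ L2) i))
                         (eval-⊗-++ʳ L L1 L2 i))
      (trans (lem (eval (t ⊗₁ L1) i) (eval (t ⊗₁ L2) i) (eval (L ⊗ L1) i) (eval (L ⊗ L2) i))
        (sym (cong₂ Z._+_ (eval-++ (t ⊗₁ L1) (L ⊗ L1) i) (eval-++ (t ⊗₁ L2) (L ⊗ L2) i)))))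
    where
    lem : ∀ a b c d → a Z.+ b Z.+ (c Z.+ d) ≡ a Z.+ c Z.+ (b Z.+ d)
    lem = solve-∀

  -- Exponent bounds guaranteeing a + b ≤ M for all products formed by ⊛.
  BdL : ℕ → θTerms → Set
  BdL K A = All (λ x → proj₂ x ≤ K) A

  BdR : ℕ → θTerms → Set
  BdR K B = All (λ y → K N.+ proj₂ y ≤ M) B

  ⊛₁-eval : ∀ c a K B → a ≤ K → BdR K B → ∀ i → eval (expandθ ((c , a) ∷ []) ⊗ expandθ B) i ≡ evalθ ((c , a) ⊛₁ B) i
  ⊛₁-eval c a K [] a≤K hB i = refl
  ⊛₁-eval c a K ((c' , b) ∷ B) a≤K (hb ∷ hB) i =
    trans (eval-⊗-++ʳ (expandθ ((c , a) ∷ [])) (expandθ ((c' , b) ∷ [])) (expandθ B) i)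
     (trans (cong₂ Z._+_ (θ-product c c' a b (NP.≤-trans (NP.+-monoˡ-≤ b a≤K) hb) i) (⊛₁-eval c a K B a≤K hB i))
       (sym (eval-++ (expandθ ((c Z.* c' , a N.+ b) ∷ (c Z.* c' , a ⊖ b) ∷ [])) (expandθ ((c , a) ⊛₁ B)) i)))

  ⊛-eval : ∀ K A B → BdL K A → BdR K B → ∀ i → eval (expandθ A ⊗ expandθ B) i ≡ evalθ (A ⊛ B) i
  ⊛-eval K [] B hA hB i = refl
  ⊛-eval K ((c , a) ∷ A) B (ha ∷ hA) hB i =
    trans (cong (λ z → eval z i) (⊗-++ˡ (expandθ ((c , a) ∷ [])) (expandθ A) (expandθ B)))
     (trans (eval-++ (expandθ ((c , a) ∷ []) ⊗ expandθ B) (expandθ A ⊗ expandθ B) i)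
      (trans (cong₂ Z._+_ (⊛₁-eval c a K B ha hB i) (⊛-eval K A B hA hB i))
       (trans (sym (eval-++ (expandθ ((c , a) ⊛₁ B)) (expandθ (A ⊛ B)) i))
         (cong (λ z → eval z i) (sym (expandθ-++ ((c , a) ⊛₁ B) (A ⊛ B)))))))


  -- Σ_(t<n) ζ^((2t+1)e): the sum of the n real embeddings σ_(2t+1) applied to ζ^e.
  halfOddSum : ℕ → ℕ → ℤ
  halfOddSum e m = sumN n (λ t → mono (suc (2 N.* t) N.* e) m)

  -- Σ_(t<N) ζ^((2t+1)e): the sum over all N odd exponents, i.e. the trace of ζ^e.
  oddSum : ℕ → ℕ → ℤ
  oddSum e m = sumN Nn (λ t → mono (suc (2 N.* t) N.* e) m)

  traceTerms : Terms → ℕ → ℤ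
  traceTerms [] m = 0ℤ
  traceTerms ((c , e) ∷ L) m = c Z.* halfOddSum e m Z.+ traceTerms L m

  sum-scaleExps : ∀ P m → sumN n (λ t → eval (scaleExps (suc (2 N.* t)) P) m) ≡ traceTerms P m
  sum-scaleExps [] m = sumN-0 n
  sum-scaleExps ((c , e) ∷ P) m =
    trans (sumN-+ n (λ t → c Z.* mono (suc (2 N.* t) N.* e) m) (λ t → eval (scaleExps (suc (2 N.* t)) P) m))
      (cong₂ Z._+_ (sumN-*ˡ n c _) (sum-scaleExps P m))

  modeq2 : ∀ x y z a b → x N.+ z ≡ a N.* M → y N.+ z ≡ b N.* M → x % M ≡ y % M
  modeq2 x y z a b h1 h2 =
    trans (sym (DM.[m+kn]%n≡m%n x b M)) (trans (cong (_% M) e) (DM.[m+kn]%n≡m%n y a M))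
    where
    e : x N.+ b N.* M ≡ y N.+ a N.* M
    e = trans (cong (x N.+_) (sym h2))
         (trans (sol x y z) (trans (cong (y N.+_) h1) refl))
      where
      sol : ∀ x y z → x N.+ (y N.+ z) ≡ y N.+ (x N.+ z)
      sol = solveℕ

  Nn≡n+n : Nn ≡ n N.+ n
  Nn≡n+n = cong (n N.+_) (NP.+-identityʳ n)

  -- The odd exponents 2t+1 for t ≥ n are the negatives of those for t < n, so the
  -- half sums of ζ^s and ζ^(M−s) add up to the full sum over all odd exponents.
  halfOddSum-conj : ∀ s m → s ≤ M → halfOddSum s m Z.+ halfOddSum (M ∸ s) m ≡ oddSum s m
  halfOddSum-conj s m s≤M =
    trans (cong (λ x → halfOddSum s m Z.+ x) step)
      (trans (sym (sumN-split n n f)) (cong (λ k → sumN k f) (sym Nn≡n+n)))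
    where
    f : ℕ → ℤ
    f t = mono (suc (2 N.* t) N.* s) m
    step : halfOddSum (M ∸ s) m ≡ sumN n (λ t → f (n N.+ t))
    step = trans (sumN-cong n (λ t t<n → mono-mod (mq t t<n) m)) (sym (sumN-rev n (λ t → f (n N.+ t))))
      where
      mq : ∀ t → t < n → (suc (2 N.* t) N.* (M ∸ s)) % M ≡ (suc (2 N.* (n N.+ (n ∸ suc t))) N.* s) % M
      mq t t<n = modeq2 _ _ (suc (2 N.* t) N.* s) (suc (2 N.* t)) s
                   (trans (sym (NP.*-distribˡ-+ (suc (2 N.* t)) (M ∸ s) s))
                      (trans (cong (suc (2 N.* t) N.*_) (NP.m∸n+n≡m s≤M)) refl))
                   (trans (cong (λ k → suc (2 N.* (k N.+ (n ∸ suc t))) N.* s N.+ suc (2 N.* t) N.* s) (sym eu))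
                     (trans (sol t (n ∸ suc t) s) (trans (cong (λ k → 2 N.* (2 N.* k) N.* s) eu) (NP.*-comm M s))))
        where
        eu : n ∸ suc t N.+ suc t ≡ n
        eu = NP.m∸n+n≡m t<n
        sol : ∀ t u s → suc (2 N.* (u N.+ suc t N.+ u)) N.* s N.+ suc (2 N.* t) N.* s ≡ 2 N.* (2 N.* (u N.+ suc t)) N.* s
        sol = solveℕ


  traceθTerms : θTerms → ℕ → ℤ
  traceθTerms [] m = 0ℤ
  traceθTerms ((c , s) ∷ Θ) m = c Z.* oddSum s m Z.+ traceθTerms Θ m

  traceTerms-θ : ∀ Θ m → All (λ x → proj₂ x ≤ M) Θ → traceTerms (expandθ Θ) m ≡ traceθTerms Θ m
  traceTerms-θ [] m _ = refl
  traceTerms-θ ((c , s) ∷ Θ) m (h ∷ hs) =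
    trans (sym (ZP.+-assoc (c Z.* halfOddSum s m) (c Z.* halfOddSum (M ∸ s) m) (traceTerms (expandθ Θ) m)))
      (cong₂ Z._+_ (trans (sym (ZP.*-distribˡ-+ c (halfOddSum s m) (halfOddSum (M ∸ s) m))) (cong (c Z.*_) (halfOddSum-conj s m h)))
                   (traceTerms-θ Θ m hs))

  -- Tr(ζ^e)/N: 1 if e ≡ 0, −1 if e ≡ N (mod M), and 0 otherwise.
  traceSign : ℕ → ℤ
  traceSign e = if (e % M) N.≡ᵇ 0 then 1ℤ else if (e % M) N.≡ᵇ Nn then - 1ℤ else 0ℤ

  0%M : 0 % M ≡ 0
  0%M = DM.m<n⇒m%n≡m (NP.<-trans N>0 N<M)

  mono0 : ∀ m → m < Nn → mono 0 m ≡ δ m 0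
  mono0 m m<N = trans (cong (λ x → monoRed x m) 0%M) (monoRed-lo {0} {m} N>0)

  mono-addmod : ∀ x y y' → y % M ≡ y' % M → ∀ m → mono (x N.+ y) m ≡ mono (x N.+ y') m
  mono-addmod x y y' eq m = mono-mod (trans (DM.%-distribˡ-+ x y M)
                              (trans (cong (λ z → (x % M N.+ z) % M) eq) (sym (DM.%-distribˡ-+ x y' M)))) m

  parity : ∀ e → Σ ℕ (λ k → (e ≡ 2 N.* k) ⊎ (e ≡ suc (2 N.* k)))
  parity zero = 0 , inj₁ refl
  parity (suc e) with parity e
  ... | k , inj₁ eq = k , inj₂ (cong suc eq)
  ... | k , inj₂ eq = suc k , inj₁ (trans (cong suc eq) (sol k))
    where
    sol : ∀ k → suc (suc (2 N.* k)) ≡ 2 N.* suc k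
    sol = solveℕ

  twoAdic : ∀ f e → e ≤ f → 0 < e → Σ ℕ (λ a → Σ ℕ (λ w → e ≡ 2 ^ a N.* suc (2 N.* w)))
  twoAdic zero zero _ ()
  twoAdic (suc f) e le pos with parity e
  ... | k , inj₂ eq = 0 , k , trans eq (sym (NP.+-identityʳ _))
  ... | zero , inj₁ eq = ⊥-elim (NP.<⇒≢ pos (sym eq))
  ... | suc k , inj₁ eq with twoAdic f (suc k) (k≤f) (s≤s z≤n)
    where
    k≤f : suc k ≤ f
    k≤f = NP.≤-pred (NP.≤-trans (subst (suc (suc k) ≤_) (sym (sol k)) (NP.m≤m+n (suc (suc k)) k))
            (subst (_≤ suc f) eq le))
      where
      sol : ∀ k → 2 N.* suc k ≡ suc (suc k) N.+ k
      sol = solveℕ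
  ... | a , w , eq' = suc a , w , trans eq (trans (cong (2 N.*_) eq') (sym (NP.*-assoc 2 (2 ^ a) _)))

  oddSumPow : ℕ → ℕ → ℕ → ℤ
  oddSumPow L e m = sumN (2 ^ L) (λ t → mono (suc (2 N.* t) N.* e) m)

  oddSumPow-split : ∀ L e m → oddSumPow (suc L) e m ≡ oddSumPow L e m Z.+ sumN (2 ^ L) (λ t → mono (suc (2 N.* t) N.* e N.+ 2 ^ suc L N.* e) m)
  oddSumPow-split L e m =
    trans (cong (λ k → sumN k g) (cong (2 ^ L N.+_) (NP.+-identityʳ (2 ^ L))))
      (trans (sumN-split (2 ^ L) (2 ^ L) g)
        (cong (λ x → oddSumPow L e m Z.+ x) (sumN-cong (2 ^ L) (λ t _ → cong (λ z → mono z m) (sol (2 ^ L) t e)))))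
    where
    g : ℕ → ℤ
    g t = mono (suc (2 N.* t) N.* e) m
    sol : ∀ P t e → suc (2 N.* (P N.+ t)) N.* e ≡ suc (2 N.* t) N.* e N.+ 2 N.* P N.* e
    sol = solveℕ

  -- If 2^(L+1) e ≡ N (mod M) the second half of the range cancels the first, and
  -- each further doubling keeps the sum at zero.
  oddSumPow-vanish : ∀ L0 e m → m < Nn → (2 ^ suc L0 N.* e) % M ≡ Nn → ∀ d → oddSumPow (d N.+ suc L0) e m ≡ 0ℤ
  oddSumPow-vanish L0 e m m<N h zero =
    trans (oddSumPow-split L0 e m)
      (trans (cong (λ x → oddSumPow L0 e m Z.+ x)
               (trans (sumN-cong (2 ^ L0) (λ t _ →
                   trans (mono-addmod (suc (2 N.* t) N.* e) _ Nn (trans h (sym N%M)) m)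
                         (mono-N (suc (2 N.* t) N.* e) m m<N)))
                 (sumN-neg (2 ^ L0) (λ t → mono (suc (2 N.* t) N.* e) m))))
        (ZP.+-inverseʳ (oddSumPow L0 e m)))
  oddSumPow-vanish L0 e m m<N h (suc d) =
    trans (oddSumPow-split (d N.+ suc L0) e m)
      (trans (cong (λ x → oddSumPow (d N.+ suc L0) e m Z.+ x)
               (sumN-cong (2 ^ (d N.+ suc L0)) (λ t _ →
                   trans (mono-addmod (suc (2 N.* t) N.* e) _ 0 (trans y0 (sym 0%M)) m)
                         (cong (λ z → mono z m) (NP.+-identityʳ _)))))
        (trans (cong₂ Z._+_ (oddSumPow-vanish L0 e m m<N h d) (oddSumPow-vanish L0 e m m<N h d)) refl))
    where
    X : ℕ
    X = 2 ^ suc L0 N.* e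
    y0 : (2 ^ suc (d N.+ suc L0) N.* e) % M ≡ 0
    y0 = trans (cong (_% M) (trans (cong (N._* e) (NP.^-distribˡ-+-* 2 (suc d) (suc L0)))
                              (NP.*-assoc (2 ^ suc d) (2 ^ suc L0) e)))
          (trans (kmodL (2 ^ suc d) X)
            (trans (cong (λ z → (2 ^ suc d N.* z) % M) h)
              (trans (cong (_% M) (sol (2 ^ d) Nn)) (DM.m*n%n≡0 (2 ^ d) M))))
      where
      sol : ∀ a b → 2 N.* a N.* b ≡ a N.* (2 N.* b)
      sol = solveℕ

  traceSignRed : ℕ → ℤ
  traceSignRed e' = if e' N.≡ᵇ 0 then 1ℤ else if e' N.≡ᵇ Nn then - 1ℤ else 0ℤ

  Nn≢0 : ¬ Nn ≡ 0
  Nn≢0 eq = NP.<⇒≢ N>0 (sym eq)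

  traceSign-gen : ∀ y → y < M → ¬ y ≡ 0 → ¬ y ≡ Nn → traceSign y ≡ 0ℤ
  traceSign-gen y yM y0 yN rewrite DM.m<n⇒m%n≡m yM | ≡ᵇ-≢ y0 | ≡ᵇ-≢ yN = refl

  traceSign-0 : traceSign 0 ≡ 1ℤ
  traceSign-0 rewrite 0%M = refl

  traceSign-N : traceSign Nn ≡ - 1ℤ
  traceSign-N rewrite N%M | ≡ᵇ-≢ Nn≢0 | ≡ᵇ-refl Nn = refl

  traceSign-lt : ∀ y → 0 < y → y < Nn → traceSign y ≡ 0ℤ
  traceSign-lt y p l = traceSign-gen y (NP.<-trans l N<M) (λ e → NP.<⇒≢ p (sym e)) (NP.<⇒≢ l)


  -- For 0 < e < M with e ≠ N the character sum vanishes: writing e = 2^a (2w+1)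
  -- with a ≤ q, oddSumPow-vanish applies; a > q would force e ∈ {0, N} or e ≥ M.
  oddSum-zero : ∀ e' m → m < Nn → e' < M → ¬ e' ≡ 0 → ¬ e' ≡ Nn → oddSum e' m ≡ 0ℤ
  oddSum-zero e' m m<N e'<M e'≢0 e'≢N with twoAdic e' e' NP.≤-refl (NP.n≢0⇒n>0 e'≢0)
  ... | a , w , eq with a N.≤? q
  ... | yes a≤q =
    subst (λ k → oddSumPow k e' m ≡ 0ℤ) ek (oddSumPow-vanish (q ∸ a) e' m m<N hN a)
    where
    ek : a N.+ suc (q ∸ a) ≡ suc q
    ek = trans (NP.+-suc a (q ∸ a)) (cong suc (NP.m+[n∸m]≡n a≤q))
    hN : (2 ^ suc (q ∸ a) N.* e') % M ≡ Nn
    hN = trans (cong (_% M) (trans (cong (2 ^ suc (q ∸ a) N.*_) eq)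
                  (trans (sym (NP.*-assoc (2 ^ suc (q ∸ a)) (2 ^ a) _))
                    (cong (N._* suc (2 N.* w)) (trans (sym (NP.^-distribˡ-+-* 2 (suc (q ∸ a)) a))
                       (cong (2 ^_) (trans (NP.+-comm (suc (q ∸ a)) a) ek)))))))
          (trans (cong (_% M) (sol Nn w)) (trans (DM.[m+kn]%n≡m%n Nn w M) N%M))
      where
      sol : ∀ x w → x N.* suc (2 N.* w) ≡ x N.+ w N.* (2 N.* x)
      sol = solveℕ
  ... | no a≰q = ⊥-elim (contra K refl)
    where
    b : ℕ
    b = a ∸ suc q
    K : ℕ
    K = 2 ^ b N.* suc (2 N.* w)
    eK : e' ≡ Nn N.* K
    eK = trans eq (trans (cong (λ z → 2 ^ z N.* suc (2 N.* w)) (sym (NP.m+[n∸m]≡n (NP.≰⇒> a≰q))))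
           (trans (cong (N._* suc (2 N.* w)) (NP.^-distribˡ-+-* 2 (suc q) b)) (NP.*-assoc Nn (2 ^ b) _)))
    contra : ∀ k → k ≡ K → ⊥
    contra zero kK = e'≢0 (trans eK (trans (cong (Nn N.*_) (sym kK)) (NP.*-zeroʳ Nn)))
    contra (suc zero) kK = e'≢N (trans eK (trans (cong (Nn N.*_) (sym kK)) (NP.*-identityʳ Nn)))
    contra (suc (suc k)) kK = NP.<⇒≱ e'<M (subst (M ≤_) (sym (trans eK (cong (Nn N.*_) (sym kK))))
                                (subst (_≤ Nn N.* suc (suc k)) (sym (NP.*-comm 2 Nn) ) (NP.*-monoʳ-≤ Nn (s≤s (s≤s z≤n)))))

  oddSum-reduced : ∀ e' m → m < Nn → e' < M → oddSum e' m ≡ (+ Nn Z.* traceSignRed e') Z.* δ m 0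
  oddSum-reduced e' m m<N e'<M with e' N.≟ 0
  ... | yes refl =
    trans (sumN-cong Nn (λ t _ → trans (cong (λ z → mono z m) (NP.*-zeroʳ (suc (2 N.* t)))) (mono0 m m<N)))
      (trans (sumN-const Nn (δ m 0)) (cong (Z._* δ m 0) (sym (ZP.*-identityʳ (+ Nn)))))
  ... | no e'≢0 with e' N.≟ Nn
  ... | yes refl rewrite ≡ᵇ-≢ Nn≢0 | ≡ᵇ-refl Nn =
    trans (sumN-cong Nn (λ t _ → trans (mono-mod (trans (cong (_% M) (sol Nn t)) (DM.[m+kn]%n≡m%n Nn t M)) m)
                                  (trans (mono-N 0 m m<N) (cong -_ (mono0 m m<N)))))
      (trans (sumN-const Nn (- δ m 0)) (lem (+ Nn) (δ m 0)))
    where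
    sol : ∀ x t → suc (2 N.* t) N.* x ≡ x N.+ t N.* (2 N.* x)
    sol = solveℕ
    lem : ∀ a b → a Z.* (- b) ≡ (a Z.* (- 1ℤ)) Z.* b
    lem = solve-∀
  ... | no e'≢N rewrite ≡ᵇ-≢ e'≢0 | ≡ᵇ-≢ e'≢N =
    trans (oddSum-zero e' m m<N e'<M e'≢0 e'≢N) (sym (trans (cong (Z._* δ m 0) (ZP.*-zeroʳ (+ Nn))) (ZP.*-zeroˡ (δ m 0))))

  oddSum-val : ∀ e m → m < Nn → oddSum e m ≡ (+ Nn Z.* traceSign e) Z.* δ m 0
  oddSum-val e m m<N =
    trans (sumN-cong Nn (λ t _ → mono-mod (kmodL (suc (2 N.* t)) e) m))
      (oddSum-reduced (e % M) m m<N (DM.m%n<n e M))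


  ⊖≤+ : ∀ a b → a ⊖ b ≤ a N.+ b
  ⊖≤+ a b = NP.+-mono-≤ (NP.m∸n≤m a b) (NP.m∸n≤m b a)

  bd-⊛₁ : ∀ K c a B → a ≤ K → BdR K B → All (λ x → proj₂ x ≤ M) ((c , a) ⊛₁ B)
  bd-⊛₁ K c a [] a≤K hB = []
  bd-⊛₁ K c a ((c' , b) ∷ B) a≤K (hb ∷ hB) =
    le ∷ NP.≤-trans (⊖≤+ a b) le ∷ bd-⊛₁ K c a B a≤K hB
    where
    le : a N.+ b ≤ M
    le = NP.≤-trans (NP.+-monoˡ-≤ b a≤K) hb

  bd-⊛ : ∀ K A B → BdL K A → BdR K B → All (λ x → proj₂ x ≤ M) (A ⊛ B)
  bd-⊛ K [] B hA hB = []
  bd-⊛ K ((c , a) ∷ A) B (ha ∷ hA) hB =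
    ++⁺ (bd-⊛₁ K c a B ha hB) (bd-⊛ K A B hA hB)

  traceθ : θTerms → ℤ
  traceθ [] = 0ℤ
  traceθ ((c , s) ∷ Θ) = c Z.* traceSign s Z.+ traceθ Θ

  traceθTerms-val : ∀ Θ m → m < Nn → traceθTerms Θ m ≡ (+ Nn Z.* traceθ Θ) Z.* δ m 0
  traceθTerms-val [] m m<N = sym (trans (cong (Z._* δ m 0) (ZP.*-zeroʳ (+ Nn))) (ZP.*-zeroˡ (δ m 0)))
  traceθTerms-val ((c , s) ∷ Θ) m m<N =
    trans (cong₂ Z._+_ (cong (c Z.*_) (oddSum-val s m m<N)) (traceθTerms-val Θ m m<N)) (lem c (+ Nn) (traceSign s) (traceθ Θ) (δ m 0))
    where
    lem : ∀ c N t T d → c Z.* ((N Z.* t) Z.* d) Z.+ (N Z.* T) Z.* d ≡ (N Z.* (c Z.* t Z.+ T)) Z.* d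
    lem = solve-∀

  -- α = 4 + θ_1 − 2θ_2 − θ_3 as a θ-combination (4 = 2θ_0).
  θα : θTerms
  θα = (+ 2 , 0) ∷ (1ℤ , 1) ∷ (- (+ 2) , 2) ∷ (- 1ℤ , 3) ∷ []

  monoM : ∀ i → mono M i ≡ mono 0 i
  monoM i = mono-mod (trans (DM.n%n≡0 M) (sym 0%M)) i

  α-eval : ∀ (i : Fin Nn) → αr r i ≡ eval (expandθ θα) (toℕ i)
  α-eval i = trans (lem (mono 0 i') (mono 1 i') (mono (M ∸ 1) i') (mono 2 i') (mono (M ∸ 2) i') (mono 3 i') (mono (M ∸ 3) i'))
                 (cong (λ z → + 2 Z.* mono 0 i' Z.+ (+ 2 Z.* z Z.+ (1ℤ Z.* mono 1 i' Z.+ (1ℤ Z.* mono (M ∸ 1) i' Z.+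
                     ((- (+ 2)) Z.* mono 2 i' Z.+ ((- (+ 2)) Z.* mono (M ∸ 2) i'
                     Z.+ ((- 1ℤ) Z.* mono 3 i' Z.+ ((- 1ℤ) Z.* mono (M ∸ 3) i' Z.+ 0ℤ))))))))
                   (sym (monoM i')))
    where
    i' : ℕ
    i' = toℕ i
    lem : ∀ a b c d e f g →
      + 4 Z.* a Z.+ ((b Z.+ c) Z.+ ((- (+ 2)) Z.* (d Z.+ e) Z.+ (- 1ℤ) Z.* (f Z.+ g)))
      ≡ + 2 Z.* a Z.+ (+ 2 Z.* a Z.+ (1ℤ Z.* b Z.+ (1ℤ Z.* c Z.+ ((- (+ 2)) Z.* d Z.+ ((- (+ 2)) Z.* e
        Z.+ ((- 1ℤ) Z.* f Z.+ ((- 1ℤ) Z.* g Z.+ 0ℤ)))))))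
    lem = solve-∀

  basisTerms : ℕ → Terms
  basisTerms zero = (1ℤ , 0) ∷ []
  basisTerms (suc s) = expandθ ((1ℤ , suc s) ∷ [])

  basis-eval' : ∀ s (i : Fin Nn) → (if s N.≡ᵇ 0 then one r else θ r s) i ≡ eval (basisTerms s) (toℕ i)
  basis-eval' zero i = sym (trans (ZP.+-identityʳ _) (ZP.*-identityˡ _))
  basis-eval' (suc s) i = lem (mono (suc s) (toℕ i)) (mono (M ∸ suc s) (toℕ i))
    where
    lem : ∀ a b → a Z.+ b ≡ 1ℤ Z.* a Z.+ (1ℤ Z.* b Z.+ 0ℤ)
    lem = solve-∀

  basis-eval : ∀ (j : Fin n) (i : Fin Nn) → basisO r j i ≡ eval (basisTerms (toℕ j)) (toℕ i)
  basis-eval j i = basis-eval' (toℕ j) i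

  θProduct : ℕ → ℕ → θTerms
  θProduct zero zero = []
  θProduct zero (suc u) = (1ℤ , suc u) ∷ []
  θProduct (suc s) zero = (1ℤ , suc s) ∷ []
  θProduct (suc s) (suc u) = (1ℤ Z.* 1ℤ , suc s N.+ suc u) ∷ (1ℤ Z.* 1ℤ , suc s ⊖ suc u) ∷ []

  basisProduct : ℕ → ℕ → Terms
  basisProduct zero zero = (1ℤ , 0) ∷ []
  basisProduct s u = expandθ (θProduct s u)

  gramTerms : ℕ → ℕ → θTerms
  gramTerms zero zero = θα
  gramTerms s u = θα ⊛ θProduct s u

  n≥1 : 1 ≤ n
  n≥1 = NP.m^n>0 2 q

  Nn≥2 : 2 ≤ Nn
  Nn≥2 = NP.*-monoʳ-≤ 2 n≥1

  M≥4 : 4 ≤ M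
  M≥4 = NP.*-monoʳ-≤ 2 Nn≥2

  s+u<N : ∀ s u → s < n → u < n → s N.+ u < Nn
  s+u<N s u s<n u<n = subst (s N.+ u <_) (sym Nn≡n+n) (NP.+-mono-< s<n u<n)

  b3 : ∀ x → x < Nn → 3 N.+ x ≤ M
  b3 x x<N = subst (3 N.+ x ≤_) (sym M≡N+N)
               (NP.+-mono-≤ Nn≥2 x<N)

  θProduct-bounded : ∀ s u → s < n → u < n → BdR 3 (θProduct s u)
  θProduct-bounded zero zero _ _ = []
  θProduct-bounded zero (suc u) _ u<n = b3 (suc u) (NP.<-≤-trans u<n (NP.≤-trans (NP.m≤m+n n n) (NP.≤-reflexive (sym Nn≡n+n)))) ∷ []
  θProduct-bounded (suc s) zero s<n _ = b3 (suc s) (NP.<-≤-trans s<n (NP.≤-trans (NP.m≤m+n n n) (NP.≤-reflexive (sym Nn≡n+n)))) ∷ []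
  θProduct-bounded (suc s) (suc u) s<n u<n =
    b3 _ (s+u<N (suc s) (suc u) s<n u<n) ∷
    NP.≤-trans (NP.+-monoʳ-≤ 3 (⊖≤+ (suc s) (suc u))) (b3 _ (s+u<N (suc s) (suc u) s<n u<n)) ∷ []

  θα-bounded : BdL 3 θα
  θα-bounded = z≤n ∷ s≤s z≤n ∷ s≤s (s≤s z≤n) ∷ s≤s (s≤s (s≤s z≤n)) ∷ []

  θα-boundedM : All (λ x → proj₂ x ≤ M) θα
  θα-boundedM = z≤n ∷ NP.≤-trans (s≤s z≤n) M≥4 ∷ NP.≤-trans (s≤s (s≤s z≤n)) M≥4 ∷ NP.≤-trans (s≤s (s≤s (s≤s z≤n))) M≥4 ∷ []

  gramTerms-bounded : ∀ s u → s < n → u < n → All (λ x → proj₂ x ≤ M) (gramTerms s u)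
  gramTerms-bounded zero zero _ _ = θα-boundedM
  gramTerms-bounded zero (suc u) s<n u<n = bd-⊛ 3 θα (θProduct zero (suc u)) θα-bounded (θProduct-bounded zero (suc u) s<n u<n)
  gramTerms-bounded (suc s) zero s<n u<n = bd-⊛ 3 θα (θProduct (suc s) zero) θα-bounded (θProduct-bounded (suc s) zero s<n u<n)
  gramTerms-bounded (suc s) (suc u) s<n u<n = bd-⊛ 3 θα (θProduct (suc s) (suc u)) θα-bounded (θProduct-bounded (suc s) (suc u) s<n u<n)

  eval-⊗unit : ∀ L i → eval (L ⊗ ((1ℤ , 0) ∷ [])) i ≡ eval L i
  eval-⊗unit [] i = refl
  eval-⊗unit ((c , e) ∷ L) i =
    cong₂ Z._+_ (cong₂ Z._*_ (ZP.*-identityʳ c) (cong (λ z → mono z i) (NP.+-identityʳ e))) (eval-⊗unit L i)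

  basisProduct-eval : ∀ s u → s < n → u < n → ∀ i → eval (basisTerms s ⊗ basisTerms u) i ≡ eval (basisProduct s u) i
  basisProduct-eval zero zero _ _ i = refl
  basisProduct-eval zero (suc u) _ _ i = refl
  basisProduct-eval (suc s) zero _ _ i = eval-⊗unit (expandθ ((1ℤ , suc s) ∷ [])) i
  basisProduct-eval (suc s) (suc u) s<n u<n i =
    θ-product 1ℤ 1ℤ (suc s) (suc u) (NP.≤-trans (NP.<⇒≤ (s+u<N (suc s) (suc u) s<n u<n)) (NP.<⇒≤ N<M)) i

  mulα-eval : ∀ s u → s < n → u < n → ∀ i → eval (expandθ θα ⊗ basisProduct s u) i ≡ evalθ (gramTerms s u) i
  mulα-eval zero zero _ _ i = eval-⊗unit (expandθ θα) i
  mulα-eval zero (suc u) s<n u<n i = ⊛-eval 3 θα (θProduct zero (suc u)) θα-bounded (θProduct-bounded zero (suc u) s<n u<n) i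
  mulα-eval (suc s) zero s<n u<n i = ⊛-eval 3 θα (θProduct (suc s) zero) θα-bounded (θProduct-bounded (suc s) zero s<n u<n) i
  mulα-eval (suc s) (suc u) s<n u<n i = ⊛-eval 3 θα (θProduct (suc s) (suc u)) θα-bounded (θProduct-bounded (suc s) (suc u) s<n u<n) i

  twInner-basis : ∀ (j k : Fin n) (m : Fin Nn) →
    twInner r (basisO r j) (basisO r k) m ≡ (+ Nn Z.* traceθ (gramTerms (toℕ j) (toℕ k))) Z.* one r m
  twInner-basis j k m =
    trans (sumF≡sumN n _ (λ t → eval (scaleExps (suc (2 N.* t)) P) (toℕ m))
             (λ t → gal-eval _ P (toℕ t) hP m))
     (trans (sum-scaleExps P (toℕ m))
      (trans (traceTerms-θ (gramTerms s u) (toℕ m) (gramTerms-bounded s u s<n u<n))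
       (trans (traceθTerms-val (gramTerms s u) (toℕ m) m<N)
         (cong (λ z → (+ Nn Z.* traceθ (gramTerms s u)) Z.* z) (sym (mono0 (toℕ m) m<N))))))
    where
    s u : ℕ
    s = toℕ j
    u = toℕ k
    s<n : s < n
    s<n = toℕ<n j
    u<n : u < n
    u<n = toℕ<n k
    m<N : toℕ m < Nn
    m<N = toℕ<n m
    P : Terms
    P = expandθ (gramTerms s u)
    hxy : ∀ i → mul r (basisO r j) (basisO r k) i ≡ eval (basisProduct s u) (toℕ i)
    hxy i = trans (mul-eval (basisO r j) (basisO r k) (basisTerms s) (basisTerms u) (basis-eval j) (basis-eval k) i)
                  (basisProduct-eval s u s<n u<n (toℕ i))
    hP : ∀ i → mul r (αr r) (mul r (basisO r j) (basisO r k)) i ≡ eval P (toℕ i)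
    hP i = trans (mul-eval (αr r) _ (expandθ θα) (basisProduct s u) α-eval hxy i) (mulα-eval s u s<n u<n (toℕ i))

  traceθ-++ : ∀ P Q → traceθ (P ++ Q) ≡ traceθ P Z.+ traceθ Q
  traceθ-++ [] Q = sym (ZP.+-identityˡ _)
  traceθ-++ ((c , s) ∷ P) Q = trans (cong (λ z → c Z.* traceSign s Z.+ z) (traceθ-++ P Q)) (sym (ZP.+-assoc (c Z.* traceSign s) (traceθ P) (traceθ Q)))

  traceθ-⊛-split : ∀ A' y B → traceθ (A' ⊛ (y ∷ B)) ≡ traceθ (A' ⊛ (y ∷ [])) Z.+ traceθ (A' ⊛ B)
  traceθ-⊛-split [] y B = refl
  traceθ-⊛-split ((c , a) ∷ A') (c' , b) B =
    trans (traceθ-++ ((c , a) ⊛₁ ((c' , b) ∷ B)) (A' ⊛ ((c' , b) ∷ B)))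
     (trans (cong (λ z → c Z.* c' Z.* traceSign (a N.+ b) Z.+ (c Z.* c' Z.* traceSign (a ⊖ b) Z.+ traceθ ((c , a) ⊛₁ B)) Z.+ z) (traceθ-⊛-split A' (c' , b) B))
      (trans (lem (c Z.* c' Z.* traceSign (a N.+ b)) (c Z.* c' Z.* traceSign (a ⊖ b)) (traceθ ((c , a) ⊛₁ B)) (traceθ (A' ⊛ ((c' , b) ∷ []))) (traceθ (A' ⊛ B)))
        (sym (cong₂ Z._+_ (traceθ-++ ((c , a) ⊛₁ ((c' , b) ∷ [])) (A' ⊛ ((c' , b) ∷ []))) (traceθ-++ ((c , a) ⊛₁ B) (A' ⊛ B))))))
    where
    lem : ∀ t1 t2 tb ty tB → t1 Z.+ (t2 Z.+ tb) Z.+ (ty Z.+ tB) ≡ t1 Z.+ (t2 Z.+ 0ℤ) Z.+ ty Z.+ (tb Z.+ tB)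
    lem = solve-∀

  ⊖-ge : ∀ a x → a ≤ x → a ⊖ x ≡ x ∸ a
  ⊖-ge a x le = cong (N._+ (x ∸ a)) (NP.m≤n⇒m∸n≡0 le)

  ⊖-add : ∀ j d → j ⊖ (d N.+ j) ≡ d
  ⊖-add j d = trans (cong₂ N._+_ (NP.m≤n⇒m∸n≡0 (NP.m≤n+m j d)) (NP.m+n∸n≡m d j)) refl

  ⊖-self : ∀ a → a ⊖ a ≡ 0
  ⊖-self a = cong₂ N._+_ (NP.n∸n≡0 a) (NP.n∸n≡0 a)

module DnBasis (n8 : ℕ) where

  -- The dimension n = 8 + n8 (n ≥ 8 since r ≥ 5).
  nn : ℕ
  nn = 8 N.+ n8

  -- Sparse integer vectors: lists of (coefficient, position).
  Entries : Set
  Entries = List (ℤ × ℕ)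

  shiftL : ℕ → Entries → Entries
  shiftL x [] = []
  shiftL x ((c , o) ∷ l) = (c , o N.+ x) ∷ shiftL x l

  blockRow0 : Entries
  blockRow0 = (1ℤ , 0) ∷ (1ℤ , 1) ∷ (- 1ℤ , 2) ∷ (- 1ℤ , 3) ∷ []

  blockRow : ℕ → Entries
  blockRow x = shiftL x blockRow0

  lastRow0 : Entries
  lastRow0 = (1ℤ , 5) ∷ (1ℤ , 6) ∷ (- (+ 2) , 7) ∷ []

  lastRow : Entries
  lastRow = shiftL n8 lastRow0

  row : ℕ → Entries
  row zero = (- 1ℤ , 0) ∷ (- 1ℤ , 1) ∷ []
  row (suc zero) = (- 1ℤ , 1) ∷ (- 1ℤ , 2) ∷ []
  row (suc (suc x)) = if (suc (suc x)) N.≡ᵇ (7 N.+ n8) then lastRow else blockRow x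

  row-last : row (7 N.+ n8) ≡ lastRow
  row-last rewrite ≡ᵇ-refl n8 = refl

  row-block : ∀ x → ¬ (2 N.+ x ≡ 7 N.+ n8) → row (2 N.+ x) ≡ blockRow x
  row-block x ne rewrite ≡ᵇ-≢ ne = refl

  evalRow : Entries → ℕ → ℤ
  evalRow [] i = 0ℤ
  evalRow ((c , p) ∷ l) i = c Z.* δ i p Z.+ evalRow l i

  basisVec : ℕ → ℕ → ℤ
  basisVec j i = evalRow (row j) i

  weigh : Entries → (ℕ → ℤ) → ℤ
  weigh [] g = 0ℤ
  weigh ((c , p) ∷ l) g = c Z.* g p Z.+ weigh l g

  dotRow : Entries → Entries → ℤ
  dotRow l l' = weigh l (evalRow l')

  Pos : Entries → Set
  Pos l = All (λ x → proj₂ x < nn) l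

  sum-evalRow : ∀ l (g : ℕ → ℤ) → Pos l → sumN nn (λ i → evalRow l i Z.* g i) ≡ weigh l g
  sum-evalRow [] g _ = trans (sumN-cong nn (λ i _ → ZP.*-zeroˡ (g i))) (sumN-0 nn)
  sum-evalRow ((c , p) ∷ l) g (h ∷ hs) =
    trans (sumN-cong nn (λ i _ → lem c (δ i p) (evalRow l i) (g i)))
     (trans (sumN-+ nn (λ i → c Z.* (δ i p Z.* g i)) (λ i → evalRow l i Z.* g i))
       (cong₂ Z._+_ (trans (sumN-*ˡ nn c (λ i → δ i p Z.* g i)) (cong (c Z.*_) (sumN-δ nn p g h))) (sum-evalRow l g hs)))
    where
    lem : ∀ c d e g → (c Z.* d Z.+ e) Z.* g ≡ c Z.* (d Z.* g) Z.+ e Z.* g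
    lem = solve-∀

  dot-evalRow : ∀ l l' → Pos l → sumN nn (λ i → evalRow l i Z.* evalRow l' i) ≡ dotRow l l'
  dot-evalRow l l' h = sum-evalRow l (evalRow l') h

  δ-shift : ∀ a b x → δ (a N.+ x) (b N.+ x) ≡ δ a b
  δ-shift a b x = cong (λ z → if z then 1ℤ else 0ℤ) (≡ᵇ-+ʳ x a b)

  evalRow-shift : ∀ x l o → evalRow (shiftL x l) (o N.+ x) ≡ evalRow l o
  evalRow-shift x [] o = refl
  evalRow-shift x ((c , p) ∷ l) o = cong₂ Z._+_ (cong (c Z.*_) (δ-shift o p x)) (evalRow-shift x l o)

  dotRow-shift : ∀ x l l' → dotRow (shiftL x l) (shiftL x l') ≡ dotRow l l'
  dotRow-shift x [] l' = refl
  dotRow-shift x ((c , o) ∷ l) l' = cong₂ Z._+_ (cong (c Z.*_) (evalRow-shift x l' o)) (dotRow-shift x l l')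

  evalRow-outside : ∀ l p → All (λ x → ¬ p ≡ proj₂ x) l → evalRow l p ≡ 0ℤ
  evalRow-outside [] p _ = refl
  evalRow-outside ((c , p') ∷ l) p (h ∷ hs) = trans (cong₂ Z._+_ (trans (cong (c Z.*_) (δ-≢ h)) (ZP.*-zeroʳ c)) (evalRow-outside l p hs)) refl

  weigh-0 : ∀ l (g : ℕ → ℤ) → All (λ x → g (proj₂ x) ≡ 0ℤ) l → weigh l g ≡ 0ℤ
  weigh-0 [] g _ = refl
  weigh-0 ((c , p) ∷ l) g (h ∷ hs) = trans (cong₂ Z._+_ (trans (cong (c Z.*_) h) (ZP.*-zeroʳ c)) (weigh-0 l g hs)) refl

  shift-comp : ∀ d x l → shiftL (d N.+ x) l ≡ shiftL x (shiftL d l)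
  shift-comp d x [] = refl
  shift-comp d x ((c , o) ∷ l) = cong₂ _∷_ (cong (c ,_) (sym (NP.+-assoc o d x))) (shift-comp d x l)

  weigh-lin : ∀ l (a : ℤ) (g h : ℕ → ℤ) → weigh l (λ p → a Z.* g p Z.+ h p) ≡ a Z.* weigh l g Z.+ weigh l h
  weigh-lin [] a g h = sym (trans (cong (Z._+ 0ℤ) (ZP.*-zeroʳ a)) refl)
  weigh-lin ((c , p) ∷ l) a g h = trans (cong (λ z → c Z.* (a Z.* g p Z.+ h p) Z.+ z) (weigh-lin l a g h))
                                   (lem c a (g p) (h p) (weigh l g) (weigh l h))
    where
    lem : ∀ c a g h pg ph → c Z.* (a Z.* g Z.+ h) Z.+ (a Z.* pg Z.+ ph) ≡ a Z.* (c Z.* g Z.+ pg) Z.+ (c Z.* h Z.+ ph)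
    lem = solve-∀

  weigh-δ : ∀ l p' → weigh l (λ p → δ p p') ≡ evalRow l p'
  weigh-δ [] p' = refl
  weigh-δ ((c , p) ∷ l) p' = cong₂ Z._+_ (cong (c Z.*_) (δ-sym p p')) (weigh-δ l p')

  dotRow-sym : ∀ l l' → dotRow l l' ≡ dotRow l' l
  dotRow-sym l [] = trans (weigh-0 l (evalRow []) (allz l)) refl
    where
    allz : ∀ l → All (λ x → evalRow [] (proj₂ x) ≡ 0ℤ) l
    allz [] = []
    allz (_ ∷ l) = refl ∷ allz l
  dotRow-sym l ((c' , p') ∷ l') =
    trans (weigh-lin l c' (λ p → δ p p') (evalRow l'))
      (cong₂ Z._+_ (cong (c' Z.*_) (weigh-δ l p')) (dotRow-sym l l'))

  data RowKind : ℕ → Set where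
    v0 : RowKind 0
    v1 : RowKind 1
    vblock : ∀ x → x < 5 N.+ n8 → RowKind (2 N.+ x)
    vlast : RowKind (7 N.+ n8)

  rowKind : ∀ j → j < nn → RowKind j
  rowKind zero _ = v0
  rowKind (suc zero) _ = v1
  rowKind (suc (suc x)) (s≤s (s≤s lt)) with x N.≟ (5 N.+ n8)
  ... | yes refl = vlast
  ... | no ne = vblock x (NP.≤∧≢⇒< (NP.≤-pred lt) ne)

  block≢last : ∀ x → x < 5 N.+ n8 → ¬ (2 N.+ x ≡ 7 N.+ n8)
  block≢last x lt eq = NP.<⇒≢ lt (NP.suc-injective (NP.suc-injective eq))

  RowSupport : ℕ → Entries → Set
  RowSupport j l = All (λ e → (proj₂ e < 2 N.+ j) × (j ≤ 2 N.+ proj₂ e) × (proj₂ e < nn)) l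

  rowSupport-block : ∀ x → x < 5 N.+ n8 → RowSupport (2 N.+ x) (blockRow x)
  rowSupport-block x lt = mk 0 (s≤s z≤n) ∷ mk 1 (s≤s (s≤s z≤n)) ∷ mk 2 (s≤s (s≤s (s≤s z≤n))) ∷ mk 3 NP.≤-refl ∷ []
    where
    mk : ∀ o → o < 4 → (o N.+ x < 2 N.+ (2 N.+ x)) × (2 N.+ x ≤ 2 N.+ (o N.+ x)) × (o N.+ x < nn)
    mk o o<4 = NP.+-monoˡ-< x o<4 , s≤s (s≤s (NP.m≤n+m x o)) ,
               NP.<-≤-trans (NP.+-monoˡ-< x o<4) (s≤s (s≤s (s≤s (s≤s (NP.≤-pred lt)))))

  rowSupport-last : RowSupport (7 N.+ n8) lastRow
  rowSupport-last = mk 5 (s≤s (s≤s (s≤s (s≤s (s≤s (s≤s z≤n)))))) (s≤s (s≤s (s≤s (s≤s (s≤s z≤n)))))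
          ∷ mk 6 (s≤s (s≤s (s≤s (s≤s (s≤s (s≤s (s≤s z≤n))))))) (s≤s (s≤s (s≤s (s≤s (s≤s z≤n)))))
          ∷ mk 7 (s≤s (s≤s (s≤s (s≤s (s≤s (s≤s (s≤s (s≤s z≤n)))))))) (s≤s (s≤s (s≤s (s≤s (s≤s z≤n))))) ∷ []
    where
    mk : ∀ o → o < 8 → 5 ≤ o → (o N.+ n8 < 2 N.+ (7 N.+ n8)) × (7 N.+ n8 ≤ 2 N.+ (o N.+ n8)) × (o N.+ n8 < nn)
    mk o o<8 o≥5 = NP.≤-trans (NP.+-monoˡ-< n8 o<8) (NP.m≤n+m (8 N.+ n8) 1) ,
                   s≤s (s≤s (NP.+-monoˡ-≤ n8 o≥5)) , NP.+-monoˡ-< n8 o<8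

  rowSupport : ∀ j → j < nn → RowSupport j (row j)
  rowSupport j lt with rowKind j lt
  ... | v0 = (s≤s z≤n , z≤n , s≤s z≤n) ∷ (s≤s (s≤s z≤n) , z≤n , s≤s (s≤s z≤n)) ∷ []
  ... | v1 = (s≤s (s≤s z≤n) , s≤s z≤n , s≤s (s≤s z≤n)) ∷ (s≤s (s≤s (s≤s z≤n)) , s≤s z≤n , s≤s (s≤s (s≤s z≤n))) ∷ []
  ... | vblock x xl = subst (RowSupport (2 N.+ x)) (sym (row-block x (block≢last x xl))) (rowSupport-block x xl)
  ... | vlast = subst (RowSupport (7 N.+ n8)) (sym row-last) rowSupport-last

  rowPositions : ∀ j → j < nn → Pos (row j)
  rowPositions j lt = All-map (λ h → proj₂ (proj₂ h)) (rowSupport j lt)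

  -- Rows whose supports are disjoint (index distance ≥ 4) are orthogonal.
  dotRow-far : ∀ j k → j < nn → k < nn → 4 N.+ j ≤ k → dotRow (row j) (row k) ≡ 0ℤ
  dotRow-far j k jl kl le = weigh-0 (row j) (evalRow (row k))
    (All-map (λ {e} h → evalRow-outside (row k) (proj₂ e)
       (All-map (λ {e'} h' eq →
          NP.<⇒≢ (NP.<-≤-trans (proj₁ h) (NP.≤-trans (NP.+-cancelˡ-≤ 2 (2 N.+ j) (proj₂ e')
                   (NP.≤-trans le (proj₁ (proj₂ h')))) NP.≤-refl)) eq) (rowSupport k kl))) (rowSupport j jl))


  L : ℕ
  L = 7 N.+ n8

  Span : (ℕ → ℤ) → Set
  Span w = Σ (ℕ → ℤ) (λ c → ∀ i → i < nn → w i ≡ sumN nn (λ j → c j Z.* basisVec j i))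

  span-basisVec : ∀ k → k < nn → Span (basisVec k)
  span-basisVec k kl = (λ j → δ j k) , λ i _ → sym (sumN-δ nn k (λ j → basisVec j i) kl)

  span-+ : ∀ {w w'} → Span w → Span w' → Span (λ i → w i Z.+ w' i)
  span-+ (c , h) (c' , h') = (λ j → c j Z.+ c' j) , λ i il →
    trans (cong₂ Z._+_ (h i il) (h' i il))
      (trans (sym (sumN-+ nn (λ j → c j Z.* basisVec j i) (λ j → c' j Z.* basisVec j i)))
        (sumN-cong nn (λ j _ → sym (ZP.*-distribʳ-+ (basisVec j i) (c j) (c' j)))))

  span-* : ∀ a {w} → Span w → Span (λ i → a Z.* w i)
  span-* a (c , h) = (λ j → a Z.* c j) , λ i il →
    trans (cong (a Z.*_) (h i il))
      (trans (sym (sumN-*ˡ nn a (λ j → c j Z.* basisVec j i)))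
        (sumN-cong nn (λ j _ → sym (ZP.*-assoc a (c j) (basisVec j i)))))

  span-ext : ∀ {w w'} → (∀ i → i < nn → w i ≡ w' i) → Span w → Span w'
  span-ext e (c , h) = c , λ i il → trans (sym (e i il)) (h i il)

  -- e_a + e_(a+1) and 2e_(n−1) lie in the span of the rows: e_0 + e_1 = −f_0,
  -- e_1 + e_2 = −f_1, and then e_(x+2) + e_(x+3) = (e_x + e_(x+1)) − f_(x+2).
  pairVec : ℕ → ℕ → ℤ
  pairVec a i = δ i a Z.+ δ i (suc a)

  basisVec-block : ∀ x i → x < 5 N.+ n8 → basisVec (2 N.+ x) i ≡ pairVec x i Z.- pairVec (2 N.+ x) i
  basisVec-block x i xl = trans (cong (λ l → evalRow l i) (row-block x (block≢last x xl)))
                   (lem (δ i x) (δ i (1 N.+ x)) (δ i (2 N.+ x)) (δ i (3 N.+ x)))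
    where
    lem : ∀ a b c d → 1ℤ Z.* a Z.+ (1ℤ Z.* b Z.+ ((- 1ℤ) Z.* c Z.+ ((- 1ℤ) Z.* d Z.+ 0ℤ))) ≡ (a Z.+ b) Z.- (c Z.+ d)
    lem = solve-∀

  span-pairVec : ∀ a → a < L → Span (pairVec a)
  span-pairVec zero _ = span-ext (λ i _ → lem (δ i 0) (δ i 1)) (span-* (- 1ℤ) (span-basisVec 0 (s≤s z≤n)))
    where
    lem : ∀ a b → (- 1ℤ) Z.* ((- 1ℤ) Z.* a Z.+ ((- 1ℤ) Z.* b Z.+ 0ℤ)) ≡ a Z.+ b
    lem = solve-∀
  span-pairVec (suc zero) _ = span-ext (λ i _ → lem (δ i 1) (δ i 2)) (span-* (- 1ℤ) (span-basisVec 1 (s≤s (s≤s z≤n))))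
    where
    lem : ∀ a b → (- 1ℤ) Z.* ((- 1ℤ) Z.* a Z.+ ((- 1ℤ) Z.* b Z.+ 0ℤ)) ≡ a Z.+ b
    lem = solve-∀
  span-pairVec (suc (suc x)) (s≤s (s≤s xl)) =
    span-ext (λ i _ → trans (cong (λ z → pairVec x i Z.+ (- 1ℤ) Z.* z) (basisVec-block x i xl'))
                        (lem (pairVec x i) (pairVec (2 N.+ x) i)))
      (span-+ (span-pairVec x (NP.<-trans (NP.≤-<-trans (NP.n≤1+n x) (NP.n<1+n (suc x))) (s≤s (s≤s xl))))
              (span-* (- 1ℤ) (span-basisVec (2 N.+ x) (NP.<-trans (s≤s (s≤s xl)) (NP.n<1+n L)))))
    where
    xl' : x < 5 N.+ n8
    xl' = xl
    lem : ∀ a b → a Z.+ (- 1ℤ) Z.* (a Z.- b) ≡ b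
    lem = solve-∀

  lastVec : ℕ → ℤ
  lastVec i = + 2 Z.* δ i L

  span-lastVec : Span lastVec
  span-lastVec = span-ext (λ i _ → trans (cong (λ z → pairVec (5 N.+ n8) i Z.+ (- 1ℤ) Z.* evalRow z i) row-last)
                               (lem (δ i (5 N.+ n8)) (δ i (6 N.+ n8)) (δ i L)))
             (span-+ (span-pairVec (5 N.+ n8) (NP.<-trans (NP.n<1+n (5 N.+ n8)) (NP.n<1+n (6 N.+ n8))))
                     (span-* (- 1ℤ) (span-basisVec L NP.≤-refl)))
    where
    lem : ∀ a b c → a Z.+ b Z.+ (- 1ℤ) Z.* (1ℤ Z.* a Z.+ (1ℤ Z.* b Z.+ (- (+ 2) Z.* c Z.+ 0ℤ))) ≡ + 2 Z.* c
    lem = solve-∀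

  Even : ℤ → Set
  Even z = Σ ℤ (λ b → z ≡ b Z.+ b)

  sumδ : ∀ p → p < nn → sumN nn (λ i → δ i p) ≡ 1ℤ
  sumδ p pl = trans (sumN-cong nn (λ i _ → sym (ZP.*-identityʳ (δ i p)))) (sumN-δ nn p (λ _ → 1ℤ) pl)

  sum-pairVec : ∀ k → k < L → sumN nn (pairVec k) ≡ + 2
  sum-pairVec k kl = trans (sumN-+ nn (λ i → δ i k) (λ i → δ i (suc k)))
                (cong₂ Z._+_ (sumδ k (NP.<-trans kl (NP.n<1+n L))) (sumδ (suc k) (s≤s kl)))

  -- Every v with even coordinate sum is in the span: subtract v_k (e_k + e_(k+1))
  -- for k = 0, …, n−2 to clear the first n−1 coordinates; the remainder is an even
  -- multiple of e_(n−1).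
  span-peel : ∀ m k → m N.+ k ≡ L → ∀ v → Even (sumN nn v) → (∀ p → p < k → v p ≡ 0ℤ) → Span v
  span-peel zero k refl v (b , eb) zb =
    span-ext e (span-* b span-lastVec)
    where
    sumv : sumN nn v ≡ v L
    sumv = trans (sumN-snoc L v) (trans (cong (Z._+ v L) (trans (sumN-cong L zb) (sumN-0 L))) (ZP.+-identityˡ (v L)))
    e : ∀ i → i < nn → b Z.* lastVec i ≡ v i
    e i il with i N.≟ L
    ... | yes refl rewrite δ-refl L = trans (lem b) (trans (sym eb) sumv)
      where
      lem : ∀ b → b Z.* (+ 2 Z.* 1ℤ) ≡ b Z.+ b
      lem = solve-∀
    ... | no ne rewrite δ-≢ ne =
      trans (ZP.*-zeroʳ b) (sym (zb i (NP.≤∧≢⇒< (NP.≤-pred il) ne)))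
  span-peel (suc m) k eq v (b , eb) zb =
    span-ext e (span-+ ih (span-* (v k) (span-pairVec k kl)))
    where
    kl : k < L
    kl = subst (k <_) eq (NP.≤-trans (s≤s (NP.m≤n+m k m)) NP.≤-refl)
    v' : ℕ → ℤ
    v' i = v i Z.- v k Z.* pairVec k i
    ev' : Even (sumN nn v')
    ev' = b Z.- v k ,
      trans (sumN-+ nn v (λ i → - (v k Z.* pairVec k i)))
       (trans (cong (λ z → sumN nn v Z.+ z) (trans (sumN-neg nn (λ i → v k Z.* pairVec k i))
                 (cong -_ (trans (sumN-*ˡ nn (v k) (pairVec k)) (cong (v k Z.*_) (sum-pairVec k kl))))))
         (trans (cong (λ z → z Z.+ - (v k Z.* + 2)) eb) (lem b (v k))))
      where
      lem : ∀ b c → b Z.+ b Z.+ - (c Z.* + 2) ≡ (b Z.- c) Z.+ (b Z.- c)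
      lem = solve-∀
    zb' : ∀ p → p < suc k → v' p ≡ 0ℤ
    zb' p (s≤s p≤k) with p N.≟ k
    ... | yes refl rewrite δ-refl p | δ-≢ {p} {suc p} (λ e → NP.<⇒≢ (NP.n<1+n p) e) = lem (v p)
      where
      lem : ∀ a → a Z.- a Z.* (1ℤ Z.+ 0ℤ) ≡ 0ℤ
      lem = solve-∀
    ... | no ne
      rewrite δ-≢ ne | δ-≢ {p} {suc k} (NP.<⇒≢ (s≤s p≤k)) | zb p (NP.≤∧≢⇒< p≤k ne) = lem (v k)
      where
      lem : ∀ a → 0ℤ Z.- a Z.* (0ℤ Z.+ 0ℤ) ≡ 0ℤ
      lem = solve-∀
    ih : Span v'
    ih = span-peel m (suc k) (trans (NP.+-suc m k) eq) v' ev' zb'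
    e : ∀ i → i < nn → v' i Z.+ v k Z.* pairVec k i ≡ v i
    e i _ = lem (v i) (v k Z.* pairVec k i)
      where
      lem : ∀ a b → a Z.- b Z.+ b ≡ a
      lem = solve-∀

  span-all : ∀ v → Even (sumN nn v) → Span v
  span-all v ev = span-peel L 0 (NP.+-identityʳ L) v ev (λ p ())


  δ-shiftˡ : ∀ a y x → δ (a N.+ y) (a N.+ x) ≡ δ y x
  δ-shiftˡ zero y x = refl
  δ-shiftˡ (suc a) y x = δ-shiftˡ a y x

  K5 : ℕ
  K5 = 5 N.+ n8

  -- Independence: given a relation Σ c_j f_j = 0, the coordinate equations
  -- E i = 0 are solved by back substitution in the pair sums d_k = c_k + c_(k+1).
  module Independence (c : ℕ → ℤ) where

    E : ℕ → ℤ
    E i = sumN nn (λ j → c j Z.* basisVec j i)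

    shiftedSum : ℕ → ℕ → ℤ
    shiftedSum a i = sumN K5 (λ x → c (2 N.+ x) Z.* δ i (a N.+ x))

    shiftedSum-in : ∀ a y → y < K5 → shiftedSum a (a N.+ y) ≡ c (2 N.+ y)
    shiftedSum-in a y yl = trans (sumN-cong K5 (λ x _ → trans (cong (c (2 N.+ x) Z.*_) (trans (δ-shiftˡ a y x) (δ-sym y x)))
                                                  (ZP.*-comm (c (2 N.+ x)) (δ x y))))
                     (sumN-δ K5 y (λ x → c (2 N.+ x)) yl)

    shiftedSum-lo : ∀ a i → i < a → shiftedSum a i ≡ 0ℤ
    shiftedSum-lo a i il = trans (sumN-cong K5 (λ x _ → trans (cong (c (2 N.+ x) Z.*_)
                      (δ-≢ (NP.<⇒≢ (NP.<-≤-trans il (NP.m≤m+n a x))))) (ZP.*-zeroʳ (c (2 N.+ x))))) (sumN-0 K5)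

    shiftedSum-hi : ∀ a i → a N.+ K5 ≤ i → shiftedSum a i ≡ 0ℤ
    shiftedSum-hi a i le = trans (sumN-cong K5 (λ x xl → trans (cong (c (2 N.+ x) Z.*_)
                      (δ-≢ (λ e → NP.<⇒≢ (NP.<-≤-trans (NP.+-monoʳ-< a xl) le) (sym e)))) (ZP.*-zeroʳ (c (2 N.+ x))))) (sumN-0 K5)

    Eshape : (d0 d1 d2 s0 s1 s2 s3 e5 e6 e7 : ℤ) → ℤ
    Eshape d0 d1 d2 s0 s1 s2 s3 e5 e6 e7 =
      c 0 Z.* ((- 1ℤ) Z.* d0 Z.+ ((- 1ℤ) Z.* d1 Z.+ 0ℤ)) Z.+
      (c 1 Z.* ((- 1ℤ) Z.* d1 Z.+ ((- 1ℤ) Z.* d2 Z.+ 0ℤ)) Z.+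
      ((s0 Z.+ (s1 Z.+ (- s2 Z.+ - s3))) Z.+
       c L Z.* (1ℤ Z.* e5 Z.+ (1ℤ Z.* e6 Z.+ ((- (+ 2)) Z.* e7 Z.+ 0ℤ)))))

    Eshape-cong : ∀ {a0 a1 a2 a3 a4 a5 a6 a7 a8 a9 b0 b1 b2 b3 b4 b5 b6 b7 b8 b9} →
      a0 ≡ b0 → a1 ≡ b1 → a2 ≡ b2 → a3 ≡ b3 → a4 ≡ b4 → a5 ≡ b5 → a6 ≡ b6 → a7 ≡ b7 → a8 ≡ b8 → a9 ≡ b9 →
      Eshape a0 a1 a2 a3 a4 a5 a6 a7 a8 a9 ≡ Eshape b0 b1 b2 b3 b4 b5 b6 b7 b8 b9
    Eshape-cong refl refl refl refl refl refl refl refl refl refl = refl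

    blockSum : ∀ i → sumN K5 (λ x → c (2 N.+ x) Z.* evalRow (blockRow x) i) ≡ shiftedSum 0 i Z.+ (shiftedSum 1 i Z.+ (- shiftedSum 2 i Z.+ - shiftedSum 3 i))
    blockSum i =
      trans (sumN-cong K5 (λ x _ → lem (c (2 N.+ x)) (δ i x) (δ i (1 N.+ x)) (δ i (2 N.+ x)) (δ i (3 N.+ x))))
       (trans (sumN-+ K5 (λ x → c (2 N.+ x) Z.* δ i x)
                 (λ x → c (2 N.+ x) Z.* δ i (1 N.+ x) Z.+ (- (c (2 N.+ x) Z.* δ i (2 N.+ x)) Z.+ - (c (2 N.+ x) Z.* δ i (3 N.+ x)))))
        (cong (λ z → shiftedSum 0 i Z.+ z)
         (trans (sumN-+ K5 (λ x → c (2 N.+ x) Z.* δ i (1 N.+ x))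
                  (λ x → - (c (2 N.+ x) Z.* δ i (2 N.+ x)) Z.+ - (c (2 N.+ x) Z.* δ i (3 N.+ x))))
          (cong (λ z → shiftedSum 1 i Z.+ z)
           (trans (sumN-+ K5 (λ x → - (c (2 N.+ x) Z.* δ i (2 N.+ x))) (λ x → - (c (2 N.+ x) Z.* δ i (3 N.+ x))))
             (cong₂ Z._+_ (sumN-neg K5 (λ x → c (2 N.+ x) Z.* δ i (2 N.+ x)))
                          (sumN-neg K5 (λ x → c (2 N.+ x) Z.* δ i (3 N.+ x)))))))))
      where
      lem : ∀ c a b d e → c Z.* (1ℤ Z.* a Z.+ (1ℤ Z.* b Z.+ ((- 1ℤ) Z.* d Z.+ ((- 1ℤ) Z.* e Z.+ 0ℤ))))
                        ≡ c Z.* a Z.+ (c Z.* b Z.+ (- (c Z.* d) Z.+ - (c Z.* e)))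
      lem = solve-∀

    E-gen : ∀ i → E i ≡ Eshape (δ i 0) (δ i 1) (δ i 2) (shiftedSum 0 i) (shiftedSum 1 i) (shiftedSum 2 i) (shiftedSum 3 i) (δ i K5) (δ i (6 N.+ n8)) (δ i L)
    E-gen i =
      cong (λ z → c 0 Z.* basisVec 0 i Z.+ (c 1 Z.* basisVec 1 i Z.+ z))
        (trans (sumN-snoc K5 (λ x → c (2 N.+ x) Z.* basisVec (2 N.+ x) i))
          (cong₂ Z._+_ (trans (sumN-cong K5 (λ x xl → cong (λ l → c (2 N.+ x) Z.* evalRow l i) (row-block x (block≢last x xl))))
                              (blockSum i))
                       (cong (λ l → c L Z.* evalRow l i) row-last)))

    d : ℕ → ℤ
    d k = c k Z.+ c (suc k)

    lemE : ∀ c0 c1 cL a0 a1 a2 s0 s1 s2 s3 e5 e6 e7 → 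
       c0 Z.* ((- 1ℤ) Z.* a0 Z.+ ((- 1ℤ) Z.* a1 Z.+ 0ℤ)) Z.+
      (c1 Z.* ((- 1ℤ) Z.* a1 Z.+ ((- 1ℤ) Z.* a2 Z.+ 0ℤ)) Z.+
      ((s0 Z.+ (s1 Z.+ (- s2 Z.+ - s3))) Z.+
       cL Z.* (1ℤ Z.* e5 Z.+ (1ℤ Z.* e6 Z.+ ((- (+ 2)) Z.* e7 Z.+ 0ℤ)))))
      ≡ s0 Z.+ s1 Z.- s2 Z.- s3 Z.- c0 Z.* (a0 Z.+ a1) Z.- c1 Z.* (a1 Z.+ a2) Z.+ cL Z.* (e5 Z.+ e6 Z.- + 2 Z.* e7)
    lemE = solve-∀

    Ecalc : ∀ i a0 a1 a2 s0 s1 s2 s3 e5 e6 e7 → δ i 0 ≡ a0 → δ i 1 ≡ a1 → δ i 2 ≡ a2 →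
      shiftedSum 0 i ≡ s0 → shiftedSum 1 i ≡ s1 → shiftedSum 2 i ≡ s2 → shiftedSum 3 i ≡ s3 → δ i K5 ≡ e5 → δ i (6 N.+ n8) ≡ e6 → δ i L ≡ e7 →
      E i ≡ s0 Z.+ s1 Z.- s2 Z.- s3 Z.- c 0 Z.* (a0 Z.+ a1) Z.- c 1 Z.* (a1 Z.+ a2) Z.+ c L Z.* (e5 Z.+ e6 Z.- + 2 Z.* e7)
    Ecalc i a0 a1 a2 s0 s1 s2 s3 e5 e6 e7 h0 h1 h2 h3 h4 h5 h6 h7 h8 h9 =
      trans (E-gen i) (trans (Eshape-cong h0 h1 h2 h3 h4 h5 h6 h7 h8 h9) (lemE (c 0) (c 1) (c L) a0 a1 a2 s0 s1 s2 s3 e5 e6 e7))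

    E0 : E 0 ≡ c 2 Z.- c 0
    E0 = trans (Ecalc 0 1ℤ 0ℤ 0ℤ (c 2) 0ℤ 0ℤ 0ℤ 0ℤ 0ℤ 0ℤ refl refl refl (shiftedSum-in 0 0 (s≤s z≤n)) (shiftedSum-lo 1 0 (s≤s z≤n))
                 (shiftedSum-lo 2 0 (s≤s z≤n)) (shiftedSum-lo 3 0 (s≤s z≤n)) refl refl refl)
               (lem (c 0) (c 1) (c 2) (c L))
      where
      lem : ∀ c0 c1 c2 cL → c2 Z.+ 0ℤ Z.- 0ℤ Z.- 0ℤ Z.- c0 Z.* (1ℤ Z.+ 0ℤ) Z.- c1 Z.* (0ℤ Z.+ 0ℤ) Z.+ cL Z.* (0ℤ Z.+ 0ℤ Z.- + 2 Z.* 0ℤ)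
             ≡ c2 Z.- c0
      lem = solve-∀

    E-lastBlock : E K5 ≡ d (6 N.+ n8) Z.- d (4 N.+ n8)
    E-lastBlock =
      trans (Ecalc K5 0ℤ 0ℤ 0ℤ 0ℤ (c (6 N.+ n8)) (c (5 N.+ n8)) (c (4 N.+ n8)) 1ℤ 0ℤ 0ℤ refl refl refl (shiftedSum-hi 0 K5 NP.≤-refl) (shiftedSum-in 1 (4 N.+ n8) (NP.n<1+n _))
                 (shiftedSum-in 2 (3 N.+ n8) (NP.<-trans (NP.n<1+n _) (NP.n<1+n _)))
                 (shiftedSum-in 3 (2 N.+ n8) (NP.<-trans (NP.n<1+n _) (NP.<-trans (NP.n<1+n _) (NP.n<1+n _))))
                 (δ-refl K5) (δ-≢ (NP.<⇒≢ (NP.n<1+n K5))) (δ-≢ (NP.<⇒≢ (NP.<-trans (NP.n<1+n K5) (NP.n<1+n _)))))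
        (lem (c 0) (c 1) (c (4 N.+ n8)) (c (5 N.+ n8)) (c (6 N.+ n8)) (c L))
      where
      lem : ∀ c0 c1 c4 c5 c6 cL → 0ℤ Z.+ c6 Z.- c5 Z.- c4 Z.- c0 Z.* (0ℤ Z.+ 0ℤ) Z.- c1 Z.* (0ℤ Z.+ 0ℤ) Z.+ cL Z.* (1ℤ Z.+ 0ℤ Z.- + 2 Z.* 0ℤ)
              ≡ (c6 Z.+ cL) Z.- (c4 Z.+ c5)
      lem = solve-∀

    E-interior : ∀ y → y < 2 N.+ n8 → E (3 N.+ y) ≡ d (4 N.+ y) Z.- d (2 N.+ y)
    E-interior y yl =
      trans (Ecalc (3 N.+ y) 0ℤ 0ℤ 0ℤ (c (5 N.+ y)) (c (4 N.+ y)) (c (3 N.+ y)) (c (2 N.+ y)) 0ℤ 0ℤ 0ℤ refl refl refl (shiftedSum-in 0 (3 N.+ y) (bnd 3 (s≤s (s≤s (s≤s z≤n)))))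
                 (shiftedSum-in 1 (2 N.+ y) (bnd 2 (s≤s (s≤s z≤n))))
                 (shiftedSum-in 2 (1 N.+ y) (bnd 1 (s≤s z≤n)))
                 (shiftedSum-in 3 y (bnd 0 z≤n))
                 (δ-≢ (λ e → NP.<⇒≢ yl (NP.suc-injective (NP.suc-injective (NP.suc-injective e)))))
                 (δ-≢ (λ e → NP.<⇒≢ (NP.<-trans yl (NP.n<1+n _)) (NP.suc-injective (NP.suc-injective (NP.suc-injective e)))))
                 (δ-≢ (λ e → NP.<⇒≢ (NP.<-trans yl (NP.<-trans (NP.n<1+n _) (NP.n<1+n _))) (NP.suc-injective (NP.suc-injective (NP.suc-injective e))))))
        (lem (c 0) (c 1) (c (2 N.+ y)) (c (3 N.+ y)) (c (4 N.+ y)) (c (5 N.+ y)) (c L))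
      where
      bnd : ∀ a → a ≤ 3 → a N.+ y < K5
      bnd a a≤3 = NP.<-≤-trans (NP.+-monoʳ-< a yl) (NP.+-monoˡ-≤ (2 N.+ n8) a≤3)
      lem : ∀ c0 c1 c2 c3 c4 c5 cL → c5 Z.+ c4 Z.- c3 Z.- c2 Z.- c0 Z.* (0ℤ Z.+ 0ℤ) Z.- c1 Z.* (0ℤ Z.+ 0ℤ) Z.+ cL Z.* (0ℤ Z.+ 0ℤ Z.- + 2 Z.* 0ℤ)
              ≡ (c4 Z.+ c5) Z.- (c2 Z.+ c3)
      lem = solve-∀

    Emid : ∀ k → k < K5 → E (suc k) ≡ d (2 N.+ k) Z.- d k
    Emid zero _ =
      trans (Ecalc 1 0ℤ 1ℤ 0ℤ (c 3) (c 2) 0ℤ 0ℤ 0ℤ 0ℤ 0ℤ refl refl refl (shiftedSum-in 0 1 (s≤s (s≤s z≤n))) (shiftedSum-in 1 0 (s≤s z≤n))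
                 (shiftedSum-lo 2 1 (s≤s (s≤s z≤n))) (shiftedSum-lo 3 1 (s≤s (s≤s z≤n))) refl refl refl)
        (lem (c 0) (c 1) (c 2) (c 3) (c L))
      where
      lem : ∀ c0 c1 c2 c3 cL → c3 Z.+ c2 Z.- 0ℤ Z.- 0ℤ Z.- c0 Z.* (0ℤ Z.+ 1ℤ) Z.- c1 Z.* (1ℤ Z.+ 0ℤ) Z.+ cL Z.* (0ℤ Z.+ 0ℤ Z.- + 2 Z.* 0ℤ)
              ≡ (c2 Z.+ c3) Z.- (c0 Z.+ c1)
      lem = solve-∀
    Emid (suc zero) _ =
      trans (Ecalc 2 0ℤ 0ℤ 1ℤ (c 4) (c 3) (c 2) 0ℤ 0ℤ 0ℤ 0ℤ refl refl refl (shiftedSum-in 0 2 (s≤s (s≤s (s≤s z≤n)))) (shiftedSum-in 1 1 (s≤s (s≤s z≤n)))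
                 (shiftedSum-in 2 0 (s≤s z≤n)) (shiftedSum-lo 3 2 (s≤s (s≤s (s≤s z≤n)))) refl refl refl)
        (lem (c 0) (c 1) (c 2) (c 3) (c 4) (c L))
      where
      lem : ∀ c0 c1 c2 c3 c4 cL → c4 Z.+ c3 Z.- c2 Z.- 0ℤ Z.- c0 Z.* (0ℤ Z.+ 0ℤ) Z.- c1 Z.* (0ℤ Z.+ 1ℤ) Z.+ cL Z.* (0ℤ Z.+ 0ℤ Z.- + 2 Z.* 0ℤ)
              ≡ (c3 Z.+ c4) Z.- (c1 Z.+ c2)
      lem = solve-∀
    Emid (suc (suc y)) (s≤s (s≤s (s≤s yl))) with y N.≟ (2 N.+ n8)
    ... | yes refl = E-lastBlock
    ... | no ne = E-interior y (NP.≤∧≢⇒< yl ne)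

    EL1 : E (6 N.+ n8) ≡ c L Z.- (c K5 Z.+ c (6 N.+ n8))
    EL1 = trans (Ecalc (6 N.+ n8) 0ℤ 0ℤ 0ℤ 0ℤ 0ℤ (c (6 N.+ n8)) (c K5) 0ℤ 1ℤ 0ℤ refl refl refl
                  (shiftedSum-hi 0 (6 N.+ n8) (NP.n≤1+n K5)) (shiftedSum-hi 1 (6 N.+ n8) NP.≤-refl)
                  (shiftedSum-in 2 (4 N.+ n8) (NP.n<1+n _)) (shiftedSum-in 3 (3 N.+ n8) (NP.<-trans (NP.n<1+n _) (NP.n<1+n _)))
                  (δ-≢ (λ e → NP.<⇒≢ (NP.n<1+n K5) (sym e))) (δ-refl (6 N.+ n8)) (δ-≢ (NP.<⇒≢ (NP.n<1+n (6 N.+ n8)))))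
            (lem (c 0) (c 1) (c K5) (c (6 N.+ n8)) (c L))
      where
      lem : ∀ c0 c1 c5 c6 cL → 0ℤ Z.+ 0ℤ Z.- c6 Z.- c5 Z.- c0 Z.* (0ℤ Z.+ 0ℤ) Z.- c1 Z.* (0ℤ Z.+ 0ℤ) Z.+ cL Z.* (0ℤ Z.+ 1ℤ Z.- + 2 Z.* 0ℤ)
              ≡ cL Z.- (c5 Z.+ c6)
      lem = solve-∀

    ELL : E L ≡ - c (6 N.+ n8) Z.- (c L Z.+ c L)
    ELL = trans (Ecalc L 0ℤ 0ℤ 0ℤ 0ℤ 0ℤ 0ℤ (c (6 N.+ n8)) 0ℤ 0ℤ 1ℤ refl refl refl
                  (shiftedSum-hi 0 L (NP.≤-trans (NP.n≤1+n K5) (NP.n≤1+n _))) (shiftedSum-hi 1 L (NP.n≤1+n _)) (shiftedSum-hi 2 L NP.≤-refl)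
                  (shiftedSum-in 3 (4 N.+ n8) (NP.n<1+n _))
                  (δ-≢ (λ e → NP.<⇒≢ (NP.<-trans (NP.n<1+n K5) (NP.n<1+n _)) (sym e)))
                  (δ-≢ (λ e → NP.<⇒≢ (NP.n<1+n (6 N.+ n8)) (sym e))) (δ-refl L))
            (lem (c 0) (c 1) (c (6 N.+ n8)) (c L))
      where
      lem : ∀ c0 c1 c6 cL → 0ℤ Z.+ 0ℤ Z.- 0ℤ Z.- c6 Z.- c0 Z.* (0ℤ Z.+ 0ℤ) Z.- c1 Z.* (0ℤ Z.+ 0ℤ) Z.+ cL Z.* (0ℤ Z.+ 0ℤ Z.- + 2 Z.* 1ℤ)
              ≡ - c6 Z.- (cL Z.+ cL)
      lem = solve-∀

    -- From E = 0: all d_k are equal to d_0, c_(n−1) = d_0 and c_(n−2) = −2d_0,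
    -- whence d_0 = 0 and then c_k = d_k − c_(k+1) = 0 from the top down.
    module BackSubstitution (hz : ∀ i → i < nn → E i ≡ 0ℤ) where
      sub0 : ∀ a b → a Z.- b ≡ 0ℤ → a ≡ b
      sub0 a b h = trans (sym (lem a b)) (trans (cong (Z._+ b) h) (ZP.+-identityˡ b))
        where
        lem : ∀ a b → a Z.- b Z.+ b ≡ a
        lem = solve-∀

      d1 : d 1 ≡ d 0
      d1 = trans (cong (λ z → c 1 Z.+ z) (sub0 (c 2) (c 0) (trans (sym E0) (hz 0 (s≤s z≤n))))) (ZP.+-comm (c 1) (c 0))

      dstep : ∀ k → k < K5 → d (2 N.+ k) ≡ d k
      dstep k kl = sub0 _ _ (trans (sym (Emid k kl)) (hz (suc k) (NP.<-trans (s≤s kl) (NP.<-trans (NP.n<1+n _) (NP.n<1+n _)))))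

      dconst : ∀ k → k ≤ 6 N.+ n8 → d k ≡ d 0
      dconst zero _ = refl
      dconst (suc zero) _ = d1
      dconst (suc (suc k)) (s≤s (s≤s kl)) = trans (dstep k (s≤s kl)) (dconst k (NP.≤-trans kl (NP.≤-trans (NP.n≤1+n _) (NP.n≤1+n _))))

      D0 : ℤ
      D0 = d 0

      cL≡ : c L ≡ D0
      cL≡ = trans (sub0 (c L) (d K5) (trans (sym EL1) (hz (6 N.+ n8) (NP.<-trans (NP.n<1+n _) (NP.n<1+n _)))))
                  (dconst K5 (NP.n≤1+n _))
      negsol : ∀ a b → - a Z.- b ≡ 0ℤ → a ≡ - b
      negsol a b h = trans (lem a b) (trans (cong (λ z → - b Z.- z) h) (ZP.+-identityʳ (- b)))
        where
        lem : ∀ a b → a ≡ - b Z.- (- a Z.- b)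
        lem = solve-∀

      c6≡ : c (6 N.+ n8) ≡ - (D0 Z.+ D0)
      c6≡ = trans (negsol (c (6 N.+ n8)) (c L Z.+ c L) (trans (sym ELL) (hz L (NP.n<1+n L))))
                  (cong (λ z → - (z Z.+ z)) cL≡)

      dbl0 : ∀ a → a Z.+ a ≡ 0ℤ → a ≡ 0ℤ
      dbl0 (+ zero) _ = refl
      dbl0 (+ suc k) ()
      dbl0 (Z.-[1+ k ]) ()

      D≡0 : D0 ≡ 0ℤ
      D≡0 = dbl0 D0 (trans (sym (ZP.neg-involutive _)) (trans (cong -_ h2) refl))
        where
        h1 : c (6 N.+ n8) Z.+ c L ≡ D0
        h1 = dconst (6 N.+ n8) NP.≤-refl
        h2 : - (D0 Z.+ D0) ≡ 0ℤ
        h2 = trans (sym (lem D0)) (trans (cong₂ (λ a b → a Z.+ b Z.- D0) (sym c6≡) (sym cL≡)) (trans (cong (Z._- D0) h1) (ZP.+-inverseʳ D0)))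
          where
          lem : ∀ x → - (x Z.+ x) Z.+ x Z.- x ≡ - (x Z.+ x)
          lem = solve-∀

      c-zero : ∀ m k → k N.+ m ≡ L → c k ≡ 0ℤ
      c-zero zero k eq = trans (cong c (trans (sym (NP.+-identityʳ k)) eq)) (trans cL≡ D≡0)
      c-zero (suc m) k eq =
        trans (lem (c k) (c (suc k)))
          (trans (cong₂ (λ a b → a Z.- b) (trans (dconst k kle) D≡0) (c-zero m (suc k) (trans (sym (NP.+-suc k m)) eq))) refl)
        where
        kle : k ≤ 6 N.+ n8
        kle = NP.≤-pred (subst (suc k ≤_) eq (subst (_≤ k N.+ suc m) (NP.+-identityʳ (suc k))
                 (subst (suc k N.+ 0 ≤_) (sym (NP.+-suc k m)) (s≤s (NP.+-monoʳ-≤ k z≤n)))))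
        lem : ∀ a b → a ≡ (a Z.+ b) Z.- b
        lem = solve-∀

      indep : ∀ k → k < nn → c k ≡ 0ℤ
      indep k kl = c-zero (L ∸ k) k (NP.m+[n∸m]≡n (NP.≤-pred kl))


  extend : (Fin nn → ℤ) → ℕ → ℤ
  extend v i with i N.<? nn
  ... | yes p = v (fromℕ< p)
  ... | no _ = 0ℤ

  extend-toℕ : ∀ (v : Fin nn → ℤ) i → v i ≡ extend v (toℕ i)
  extend-toℕ v i with toℕ i N.<? nn
  ... | yes p = cong v (sym (fromℕ<-toℕ i p))
  ... | no np = ⊥-elim (np (toℕ<n i))

  fD : Fin nn → Fin nn → ℤ
  fD j i = basisVec (toℕ j) (toℕ i)

  sumFN : ∀ (v : Fin nn → ℤ) → sumF nn v ≡ sumN nn (extend v)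
  sumFN v = sumF≡sumN nn v (extend v) (extend-toℕ v)

  basisVec-inD : ∀ j → j < nn → (+ 2) ∣ sumN nn (basisVec j)
  basisVec-inD j jl = subst (λ z → (+ 2) ∣ z)
                 (sym (trans (sumN-cong nn (λ i _ → sym (ZP.*-identityʳ (basisVec j i)))) (sum-evalRow (row j) (λ _ → 1ℤ) (rowPositions j jl))))
                 (go j jl)
    where
    go : ∀ j → j < nn → (+ 2) ∣ weigh (row j) (λ _ → 1ℤ)
    go j jl with rowKind j jl
    ... | v0 = divides 1 refl
    ... | v1 = divides 1 refl
    ... | vblock x xl rewrite row-block x (block≢last x xl) = divides 0 refl
    ... | vlast rewrite row-last = divides 0 refl

  even-of-∣ : ∀ z → (+ 2) ∣ z → Even z
  even-of-∣ (+ m) (divides k eq) = + k , cong +_ (trans eq (lem k))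
    where
    lem : ∀ k → k N.* 2 ≡ k N.+ k
    lem = solveℕ
  even-of-∣ (Z.-[1+ m ]) (divides k eq) =
    - (+ k) , trans (cong (λ t → - (+ t)) (trans eq (lem k))) (ZP.neg-distrib-+ (+ k) (+ k))
    where
    lem : ∀ k → k N.* 2 ≡ k N.+ k
    lem = solveℕ

  inD-even : (v : Fin nn → ℤ) → InD nn v → Even (sumN nn (extend v))
  inD-even v h = even-of-∣ (sumN nn (extend v)) (subst (λ z → (+ 2) ∣ z) (sumFN v) h)

  span-D : (v : Fin nn → ℤ) → InD nn v → Span (extend v)
  span-D v h = span-all (extend v) (inD-even v h)

  sumN-toFin : ∀ (cN : ℕ → ℤ) (i : Fin nn) → sumN nn (λ j → cN j Z.* basisVec j (toℕ i)) ≡ sumF nn (λ j → cN (toℕ j) Z.* fD j i)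
  sumN-toFin cN i = sym (sumF≡sumN nn (λ j → cN (toℕ j) Z.* fD j i) (λ j → cN j Z.* basisVec j (toℕ i)) (λ _ → refl))

  rows-span : (v : Fin nn → ℤ) → InD nn v → Σ (Fin nn → ℤ) (λ c → (i : Fin nn) → v i ≡ sumF nn (λ j → c j Z.* fD j i))
  rows-span v h = (λ j → proj₁ (span-D v h) (toℕ j)) , λ i →
      trans (extend-toℕ v i) (trans (proj₂ (span-D v h) (toℕ i) (toℕ<n i)) (sumN-toFin (proj₁ (span-D v h)) i))

  relation-ℕ : (c : Fin nn → ℤ) → ((i : Fin nn) → sumF nn (λ j → c j Z.* fD j i) ≡ 0ℤ) → ∀ i → i < nn → Independence.E (extend c) i ≡ 0ℤ
  relation-ℕ c h i il = trans (cong (λ t → sumN nn (λ j → extend c j Z.* basisVec j t)) (sym (toℕ-fromℕ< il)))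
                  (trans (sym (sumF≡sumN nn (λ j → c j Z.* fD j (fromℕ< il)) (λ j → extend c j Z.* basisVec j (toℕ (fromℕ< il)))
                            (λ j → cong (Z._* basisVec (toℕ j) (toℕ (fromℕ< il))) (extend-toℕ c j))))
                    (h (fromℕ< il)))

  rows-independent : (c : Fin nn → ℤ) → ((i : Fin nn) → sumF nn (λ j → c j Z.* fD j i) ≡ 0ℤ) → (j : Fin nn) → c j ≡ 0ℤ
  rows-independent c h j = trans (extend-toℕ c j) (Independence.BackSubstitution.indep (extend c) (relation-ℕ c h) (toℕ j) (toℕ<n j))

  rows-inD : (j : Fin nn) → InD nn (fD j)
  rows-inD j = subst (λ z → (+ 2) ∣ z)
                (sym (sumF≡sumN nn (fD j) (basisVec (toℕ j)) (λ _ → refl)))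
                (basisVec-inD (toℕ j) (toℕ<n j))

  rows-basisD : IsBasisD nn fD
  rows-basisD = rows-inD , rows-span , rows-independent

module GramMatch (q n8 : ℕ) (hn : 2 ^ q ≡ 8 N.+ n8) where
  open Cyclotomic q
  module Dn = DnBasis n8
  open Dn using (dotRow; dotRow-sym; dotRow-shift; row; row-block; row-last; block≢last;
                 blockRow0; lastRow0; shiftL; shift-comp; nn; rowKind; v0; v1; vblock; vlast)

  Nn≡ : Nn ≡ 16 N.+ (n8 N.+ n8)
  Nn≡ = trans Nn≡n+n (trans (cong₂ N._+_ hn hn) (sol n8))
    where
    sol : ∀ m → 8 N.+ m N.+ (8 N.+ m) ≡ 16 N.+ (m N.+ m)
    sol = solveℕ

  -- αθ x = traceθ(α θ_x): the normalised trace of α θ_x.  Since α θ_x expands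
  -- into θ_(x+c), θ_|c−x| for c = 0, …, 3, it only depends on traceSign there.
  αθ : ℕ → ℤ
  αθ x = traceθ (θα ⊛ ((1ℤ , x) ∷ []))

  αθ-expand : ∀ x t0 t0' t1 t1' t2 t2' t3 t3' → traceSign x ≡ t0 → traceSign (0 ⊖ x) ≡ t0' → traceSign (1 N.+ x) ≡ t1 → traceSign (1 ⊖ x) ≡ t1' →
          traceSign (2 N.+ x) ≡ t2 → traceSign (2 ⊖ x) ≡ t2' → traceSign (3 N.+ x) ≡ t3 → traceSign (3 ⊖ x) ≡ t3' →
          αθ x ≡ + 2 Z.* (t0 Z.+ t0') Z.+ (t1 Z.+ t1') Z.- + 2 Z.* (t2 Z.+ t2') Z.- (t3 Z.+ t3')
  αθ-expand x t0 t0' t1 t1' t2 t2' t3 t3' refl refl refl refl refl refl refl refl =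
    lem (traceSign x) (traceSign (0 ⊖ x)) (traceSign (1 N.+ x)) (traceSign (1 ⊖ x)) (traceSign (2 N.+ x)) (traceSign (2 ⊖ x)) (traceSign (3 N.+ x)) (traceSign (3 ⊖ x))
    where
    lem : ∀ t0 t0' t1 t1' t2 t2' t3 t3' →
      + 2 Z.* t0 Z.+ (+ 2 Z.* t0' Z.+ (1ℤ Z.* t1 Z.+ (1ℤ Z.* t1' Z.+ ((- (+ 2)) Z.* t2 Z.+ ((- (+ 2)) Z.* t2'
        Z.+ ((- 1ℤ) Z.* t3 Z.+ ((- 1ℤ) Z.* t3' Z.+ 0ℤ)))))))
      ≡ + 2 Z.* (t0 Z.+ t0') Z.+ (t1 Z.+ t1') Z.- + 2 Z.* (t2 Z.+ t2') Z.- (t3 Z.+ t3')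
    lem = solve-∀

  X : ℕ
  X = n8 N.+ n8

  -- Numerals below 16 are below N; the bound is decided by evaluation.
  lt16 : ∀ y {_ : T (y N.<ᵇ 16)} → y < Nn
  lt16 y {l} = subst (y <_) (sym Nn≡) (NP.<-≤-trans (NP.<ᵇ⇒< y 16 l) (NP.m≤m+n 16 X))

  traceSign-small : ∀ y {_ : T (0 N.<ᵇ y)} {_ : T (y N.<ᵇ 16)} → traceSign y ≡ 0ℤ
  traceSign-small y {p} {l} = traceSign-lt y (NP.<ᵇ⇒< 0 y p) (lt16 y {l})

  traceSign-smallX : ∀ c {_ : T (0 N.<ᵇ c)} {_ : T (c N.<ᵇ 16)} → traceSign (c N.+ X) ≡ 0ℤ
  traceSign-smallX c {p} {l} = traceSign-lt (c N.+ X) (NP.<-≤-trans (NP.<ᵇ⇒< 0 c p) (NP.m≤m+n c X))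
                   (subst (c N.+ X <_) (sym Nn≡) (NP.+-monoˡ-< X (NP.<ᵇ⇒< c 16 l)))

  p1 : ∀ {k} → 0 < suc k
  p1 = s≤s z≤n

  αθ0 : αθ 0 ≡ + 4
  αθ0 = trans (αθ-expand 0 1ℤ 1ℤ 0ℤ 0ℤ 0ℤ 0ℤ 0ℤ 0ℤ traceSign-0 traceSign-0 (traceSign-small 1) (traceSign-small 1)
               (traceSign-small 2) (traceSign-small 2) (traceSign-small 3) (traceSign-small 3)) refl

  αθ1 : αθ 1 ≡ 1ℤ
  αθ1 = trans (αθ-expand 1 0ℤ 0ℤ 0ℤ 1ℤ 0ℤ 0ℤ 0ℤ 0ℤ (traceSign-small 1) (traceSign-small 1) (traceSign-small 2) traceSign-0
               (traceSign-small 3) (traceSign-small 1) (traceSign-small 4) (traceSign-small 2)) refl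

  αθ2 : αθ 2 ≡ - (+ 2)
  αθ2 = trans (αθ-expand 2 0ℤ 0ℤ 0ℤ 0ℤ 0ℤ 1ℤ 0ℤ 0ℤ (traceSign-small 2) (traceSign-small 2) (traceSign-small 3)
               (traceSign-small 1) (traceSign-small 4) traceSign-0 (traceSign-small 5) (traceSign-small 1)) refl

  αθ3 : αθ 3 ≡ - 1ℤ
  αθ3 = trans (αθ-expand 3 0ℤ 0ℤ 0ℤ 0ℤ 0ℤ 0ℤ 0ℤ 1ℤ (traceSign-small 3) (traceSign-small 3) (traceSign-small 4)
               (traceSign-small 2) (traceSign-small 5) (traceSign-small 1) (traceSign-small 6) traceSign-0) refl

  αθ14 : αθ (14 N.+ X) ≡ + 2
  αθ14 = trans (αθ-expand (14 N.+ X) 0ℤ 0ℤ 0ℤ 0ℤ (- 1ℤ) 0ℤ 0ℤ 0ℤ (traceSign-smallX 14)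
                 (trans (cong traceSign (⊖-ge 0 _ z≤n)) (traceSign-smallX 14)) (traceSign-smallX 15)
                 (trans (cong traceSign (⊖-ge 1 _ (s≤s z≤n))) (traceSign-smallX 13))
                 (trans (cong traceSign (sym Nn≡)) traceSign-N)
                 (trans (cong traceSign (⊖-ge 2 _ (s≤s (s≤s z≤n)))) (traceSign-smallX 12))
                 t17
                 (trans (cong traceSign (⊖-ge 3 _ (s≤s (s≤s (s≤s z≤n))))) (traceSign-smallX 11))) refl
    where
    t17 : traceSign (17 N.+ X) ≡ 0ℤ
    t17 = traceSign-gen (17 N.+ X) l (λ ()) (λ e → NP.<⇒≢ (NP.n<1+n (16 N.+ X)) (sym (trans e Nn≡)))
      where
      l : 17 N.+ X < M
      l = subst (17 N.+ X <_) (sym (trans M≡N+N (cong₂ N._+_ Nn≡ Nn≡)))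
            (NP.+-monoˡ-< (16 N.+ X) {1} {16 N.+ X} (s≤s (s≤s z≤n)))

  αθ13 : αθ (13 N.+ X) ≡ 1ℤ
  αθ13 = trans (αθ-expand (13 N.+ X) 0ℤ 0ℤ 0ℤ 0ℤ 0ℤ 0ℤ (- 1ℤ) 0ℤ (traceSign-smallX 13)
                 (trans (cong traceSign (⊖-ge 0 _ z≤n)) (traceSign-smallX 13)) (traceSign-smallX 14)
                 (trans (cong traceSign (⊖-ge 1 _ (s≤s z≤n))) (traceSign-smallX 12))
                 (traceSign-smallX 15)
                 (trans (cong traceSign (⊖-ge 2 _ (s≤s (s≤s z≤n)))) (traceSign-smallX 11))
                 (trans (cong traceSign (sym Nn≡)) traceSign-N)
                 (trans (cong traceSign (⊖-ge 3 _ (s≤s (s≤s (s≤s z≤n))))) (traceSign-smallX 10))) refl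

  αθ-far : ∀ x → 4 ≤ x → x N.+ 4 ≤ Nn → αθ x ≡ 0ℤ
  αθ-far x x≥4 xN = trans (αθ-expand x 0ℤ 0ℤ 0ℤ 0ℤ 0ℤ 0ℤ 0ℤ 0ℤ (hp 0 z≤n) (hm 0 z≤n) (hp 1 (s≤s z≤n)) (hm 1 (s≤s z≤n))
                        (hp 2 (s≤s (s≤s z≤n))) (hm 2 (s≤s (s≤s z≤n))) (hp 3 (s≤s (s≤s (s≤s z≤n)))) (hm 3 (s≤s (s≤s (s≤s z≤n))))) refl
    where
    x<N : x < Nn
    x<N = NP.<-≤-trans (NP.m<m+n x {4} (s≤s z≤n)) xN
    hp : ∀ a → a ≤ 3 → traceSign (a N.+ x) ≡ 0ℤ
    hp a a≤3 = traceSign-lt (a N.+ x) (NP.<-≤-trans (s≤s z≤n) (NP.≤-trans x≥4 (NP.m≤n+m x a)))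
                 (NP.<-≤-trans (NP.+-monoˡ-< x (s≤s a≤3)) (subst (_≤ Nn) (NP.+-comm x 4) xN))
    hm : ∀ a → a ≤ 3 → traceSign (a ⊖ x) ≡ 0ℤ
    hm a a≤3 = trans (cong traceSign (⊖-ge a x ax))
                 (traceSign-lt (x ∸ a) (NP.m<n⇒0<n∸m (NP.<-≤-trans (s≤s a≤3) x≥4)) (NP.≤-<-trans (NP.m∸n≤m x a) x<N))
      where
      ax : a ≤ x
      ax = NP.≤-trans a≤3 (NP.≤-trans (NP.n≤1+n 3) x≥4)

  gram-pos : ∀ j k → 0 < j → 0 < k → traceθ (gramTerms j k) ≡ αθ (j N.+ k) Z.+ αθ (j ⊖ k)
  gram-pos (suc s) (suc u) _ _ = traceθ-⊛-split θα (1ℤ Z.* 1ℤ , suc s N.+ suc u) ((1ℤ Z.* 1ℤ , suc s ⊖ suc u) ∷ [])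

  gram00 : traceθ (gramTerms 0 0) ≡ + 2
  gram00 rewrite traceSign-0 | traceSign-small 1 {_} {_} | traceSign-small 2 {_} {_} | traceSign-small 3 {_} {_} = refl

  αθ-block : ∀ d → d ≤ 3 → αθ d ≡ dotRow blockRow0 (shiftL d blockRow0)
  αθ-block zero _ = αθ0
  αθ-block (suc zero) _ = αθ1
  αθ-block (suc (suc zero)) _ = αθ2
  αθ-block (suc (suc (suc zero))) _ = αθ3
  αθ-block (suc (suc (suc (suc d)))) (s≤s (s≤s (s≤s ())))

  N≡nn+nn : Nn ≡ nn N.+ nn
  N≡nn+nn = trans Nn≡n+n (cong₂ N._+_ hn hn)

  gram-sym : ∀ j k → traceθ (gramTerms j k) ≡ traceθ (gramTerms k j)
  gram-sym zero zero = refl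
  gram-sym zero (suc u) = refl
  gram-sym (suc s) zero = refl
  gram-sym (suc s) (suc u) = trans (gram-pos (suc s) (suc u) p1 p1)
    (trans (cong₂ (λ a b → αθ a Z.+ αθ b) (NP.+-comm (suc s) (suc u)) (⊖-comm (suc s) (suc u))) (sym (gram-pos (suc u) (suc s) p1 p1)))

  row+4≤N : ∀ k → k < nn → k N.+ 4 ≤ Nn
  row+4≤N k kl = subst (k N.+ 4 ≤_) (sym N≡nn+nn) (NP.+-mono-≤ (NP.<⇒≤ kl) (s≤s (s≤s (s≤s (s≤s z≤n)))))

  gram-far : ∀ j k → 4 N.+ j ≤ k → k < nn → traceθ (gramTerms j k) ≡ dotRow (row j) (row k)
  gram-far zero zero () kl
  gram-far (suc s) zero () kl
  gram-far zero (suc u) le kl = trans (αθ-far (suc u) le (row+4≤N (suc u) kl)) (sym (Dn.dotRow-far 0 (suc u) (s≤s z≤n) kl le))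
  gram-far (suc s) (suc u) le kl =
    trans (gram-pos (suc s) (suc u) p1 p1)
     (trans (cong₂ Z._+_ (αθ-far _ (NP.≤-trans (NP.≤-trans (NP.m≤m+n 4 (suc s)) le) (NP.m≤n+m (suc u) (suc s))) j+k)
                         (trans (cong αθ (trans (cong (suc s ⊖_) (sym ek)) (⊖-add (suc s) (suc u ∸ suc s))))
                           (αθ-far _ d≥4 (row+4≤N _ (NP.≤-<-trans (NP.m∸n≤m (suc u) (suc s)) kl)))))
       (sym (Dn.dotRow-far (suc s) (suc u) (NP.<-trans (NP.<-≤-trans (NP.m<n+m (suc s) {4} (s≤s z≤n)) le) kl) kl le)))
    where
    ek : suc u ∸ suc s N.+ suc s ≡ suc u
    ek = NP.m∸n+n≡m (NP.≤-trans (NP.m≤n+m (suc s) 4) le)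
    d≥4 : 4 ≤ suc u ∸ suc s
    d≥4 = subst (_≤ suc u ∸ suc s) (NP.m+n∸n≡m 4 (suc s)) (NP.∸-monoˡ-≤ (suc s) le)
    j+k : suc s N.+ suc u N.+ 4 ≤ Nn
    j+k = subst (suc s N.+ suc u N.+ 4 ≤_) (sym N≡nn+nn)
            (NP.≤-trans (NP.≤-reflexive (sol (suc s) (suc u)))
              (NP.≤-trans (NP.+-mono-≤ le (NP.≤-refl {suc u})) (NP.+-mono-≤ (NP.<⇒≤ kl) (NP.<⇒≤ kl))))
      where
      sol : ∀ a b → a N.+ b N.+ 4 ≡ 4 N.+ a N.+ b
      sol = solveℕ

  near0 : ∀ d → d ≤ 3 → traceθ (gramTerms 0 d) ≡ dotRow (row 0) (row d)
  near0 zero _ = gram00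
  near0 (suc zero) _ = αθ1
  near0 (suc (suc zero)) _ = αθ2
  near0 (suc (suc (suc zero))) _ = αθ3
  near0 (suc (suc (suc (suc d)))) (s≤s (s≤s (s≤s ())))

  αθ4 : αθ 4 ≡ 0ℤ
  αθ4 = αθ-far 4 NP.≤-refl (NP.<⇒≤ (lt16 8))

  αθ5 : αθ 5 ≡ 0ℤ
  αθ5 = αθ-far 5 (NP.n≤1+n 4) (NP.<⇒≤ (lt16 9))

  near1 : ∀ d → d ≤ 3 → traceθ (gramTerms 1 (suc d)) ≡ dotRow (row 1) (row (suc d))
  near1 zero _ = trans (gram-pos 1 1 p1 p1) (cong₂ Z._+_ αθ2 αθ0)
  near1 (suc zero) _ = trans (gram-pos 1 2 p1 p1) (cong₂ Z._+_ αθ3 αθ1)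
  near1 (suc (suc zero)) _ = trans (gram-pos 1 3 p1 p1) (cong₂ Z._+_ αθ4 αθ2)
  near1 (suc (suc (suc zero))) _ = trans (gram-pos 1 4 p1 p1) (cong₂ Z._+_ αθ5 αθ3)
  near1 (suc (suc (suc (suc d)))) (s≤s (s≤s (s≤s ())))

  nearReg : ∀ d x → d ≤ 3 → x < 5 N.+ n8 → d N.+ (2 N.+ x) < nn → ¬ (d N.+ (2 N.+ x) ≡ 7 N.+ n8) →
            traceθ (gramTerms (2 N.+ x) (d N.+ (2 N.+ x))) ≡ dotRow (row (2 N.+ x)) (row (d N.+ (2 N.+ x)))
  nearReg d x d≤3 xl kl kne =
    trans (gram-pos (2 N.+ x) k p1 (NP.<-≤-trans p1 (NP.m≤n+m (2 N.+ x) d)))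
     (trans (cong₂ Z._+_ (αθ-far _ four bnd) (cong αθ (⊖-add (2 N.+ x) d)))
      (trans (ZP.+-identityˡ _)
       (trans (αθ-block d d≤3)
        (sym (trans (cong₂ dotRow (row-block x (block≢last x xl))
                       (trans (cong row ek) (trans (row-block (d N.+ x) ne') (shift-comp d x blockRow0))))
               (dotRow-shift x blockRow0 (shiftL d blockRow0)))))))
    where
    k : ℕ
    k = d N.+ (2 N.+ x)
    ek : k ≡ 2 N.+ (d N.+ x)
    ek = trans (NP.+-suc d (suc x)) (cong suc (NP.+-suc d x))
    ne' : ¬ (2 N.+ (d N.+ x) ≡ 7 N.+ n8)
    ne' e = kne (trans ek e)
    k≤ : k ≤ 6 N.+ n8
    k≤ = NP.≤-pred (NP.≤∧≢⇒< (NP.≤-pred kl) kne)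
    four : 4 ≤ 2 N.+ x N.+ k
    four = NP.+-mono-≤ {2} {2 N.+ x} {2} {k} (s≤s (s≤s z≤n)) (NP.≤-trans (s≤s (s≤s z≤n)) (NP.m≤n+m (2 N.+ x) d))
    bnd : 2 N.+ x N.+ k N.+ 4 ≤ Nn
    bnd = subst (2 N.+ x N.+ k N.+ 4 ≤_) (sym N≡nn+nn)
            (NP.≤-trans (NP.+-monoˡ-≤ 4 (NP.+-mono-≤ (NP.≤-trans (NP.m≤n+m (2 N.+ x) d) k≤) k≤))
              (NP.≤-reflexive (sol n8)))
      where
      sol : ∀ m → 6 N.+ m N.+ (6 N.+ m) N.+ 4 ≡ 8 N.+ m N.+ (8 N.+ m)
      sol = solveℕ

  dotRow-blockLast : ∀ o → o < 5 → dotRow (row (2 N.+ (o N.+ n8))) (row (7 N.+ n8)) ≡ dotRow (shiftL o blockRow0) lastRow0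
  dotRow-blockLast o ol = trans (cong₂ dotRow (trans (row-block (o N.+ n8) (block≢last (o N.+ n8) (NP.+-monoˡ-< n8 ol))) (shift-comp o n8 blockRow0)) row-last)
                  (dotRow-shift n8 (shiftL o blockRow0) lastRow0)

  +-twoShifts : ∀ a b → a N.+ n8 N.+ (b N.+ n8) ≡ (a N.+ b) N.+ X
  +-twoShifts a b = sol a b n8
    where
    sol : ∀ a b m → a N.+ m N.+ (b N.+ m) ≡ (a N.+ b) N.+ (m N.+ m)
    sol = solveℕ

  nearN-bound : ∀ c → c ≤ 12 → 4 ≤ c → c N.+ X N.+ 4 ≤ Nn
  nearN-bound c c≤ _ = subst (c N.+ X N.+ 4 ≤_) (sym Nn≡) (NP.≤-trans (NP.≤-reflexive (sol c X)) (NP.+-monoˡ-≤ X (NP.+-monoˡ-≤ 4 c≤)))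
    where
    sol : ∀ c x → c N.+ x N.+ 4 ≡ c N.+ 4 N.+ x
    sol = solveℕ

  -- The entries between a block row and the last row use αθ near N.
  nearLast1 : traceθ (gramTerms (6 N.+ n8) (7 N.+ n8)) ≡ dotRow (row (6 N.+ n8)) (row (7 N.+ n8))
  nearLast1 = trans (gram-pos (6 N.+ n8) (7 N.+ n8) p1 p1)
    (trans (cong₂ Z._+_ (trans (cong αθ (+-twoShifts 6 7)) αθ13) (trans (cong αθ (⊖-add (6 N.+ n8) 1)) αθ1))
      (sym (dotRow-blockLast 4 (s≤s (s≤s (s≤s (s≤s (s≤s z≤n))))))))

  nearLast2 : traceθ (gramTerms (5 N.+ n8) (7 N.+ n8)) ≡ dotRow (row (5 N.+ n8)) (row (7 N.+ n8))
  nearLast2 = trans (gram-pos (5 N.+ n8) (7 N.+ n8) p1 p1)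
    (trans (cong₂ Z._+_ (trans (cong αθ (+-twoShifts 5 7)) (αθ-far (12 N.+ X) (NP.≤-trans (l4 12) (NP.m≤m+n 12 X)) (nearN-bound 12 NP.≤-refl (l4 12))))
                        (trans (cong αθ (⊖-add (5 N.+ n8) 2)) αθ2))
      (sym (dotRow-blockLast 3 (s≤s (s≤s (s≤s (s≤s z≤n)))))))
    where
    l4 : ∀ c → 4 ≤ 12
    l4 _ = s≤s (s≤s (s≤s (s≤s z≤n)))

  nearLast3 : traceθ (gramTerms (4 N.+ n8) (7 N.+ n8)) ≡ dotRow (row (4 N.+ n8)) (row (7 N.+ n8))
  nearLast3 = trans (gram-pos (4 N.+ n8) (7 N.+ n8) p1 p1)
    (trans (cong₂ Z._+_ (trans (cong αθ (+-twoShifts 4 7)) (αθ-far (11 N.+ X) (NP.≤-trans l4 (NP.m≤m+n 11 X)) (nearN-bound 11 (NP.n≤1+n 11) l4)))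
                        (trans (cong αθ (⊖-add (4 N.+ n8) 3)) αθ3))
      (sym (dotRow-blockLast 2 (s≤s (s≤s (s≤s z≤n))))))
    where
    l4 : 4 ≤ 11
    l4 = s≤s (s≤s (s≤s (s≤s z≤n)))

  lastlast : traceθ (gramTerms (7 N.+ n8) (7 N.+ n8)) ≡ dotRow (row (7 N.+ n8)) (row (7 N.+ n8))
  lastlast = trans (gram-pos (7 N.+ n8) (7 N.+ n8) p1 p1)
    (trans (cong₂ Z._+_ (trans (cong αθ (+-twoShifts 7 7)) αθ14) (trans (cong αθ (⊖-self (7 N.+ n8))) αθ0))
      (sym (trans (cong₂ dotRow row-last row-last) (dotRow-shift n8 lastRow0 lastRow0))))

  nearRegLast : ∀ d x → d ≤ 3 → x < 5 N.+ n8 → d N.+ (2 N.+ x) ≡ 7 N.+ n8 →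
            traceθ (gramTerms (2 N.+ x) (d N.+ (2 N.+ x))) ≡ dotRow (row (2 N.+ x)) (row (d N.+ (2 N.+ x)))
  nearRegLast zero x _ xl eq = ⊥-elim (block≢last x xl eq)
  nearRegLast (suc zero) x _ xl eq = go x (NP.suc-injective (NP.suc-injective (NP.suc-injective eq)))
    where
    go : ∀ x → x ≡ 4 N.+ n8 → traceθ (gramTerms (2 N.+ x) (1 N.+ (2 N.+ x))) ≡ dotRow (row (2 N.+ x)) (row (1 N.+ (2 N.+ x)))
    go _ refl = nearLast1
  nearRegLast (suc (suc zero)) x _ xl eq = go x (NP.suc-injective (NP.suc-injective (NP.suc-injective (NP.suc-injective eq))))
    where
    go : ∀ x → x ≡ 3 N.+ n8 → traceθ (gramTerms (2 N.+ x) (2 N.+ (2 N.+ x))) ≡ dotRow (row (2 N.+ x)) (row (2 N.+ (2 N.+ x)))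
    go _ refl = nearLast2
  nearRegLast (suc (suc (suc zero))) x _ xl eq =
    go x (NP.suc-injective (NP.suc-injective (NP.suc-injective (NP.suc-injective (NP.suc-injective eq)))))
    where
    go : ∀ x → x ≡ 2 N.+ n8 → traceθ (gramTerms (2 N.+ x) (3 N.+ (2 N.+ x))) ≡ dotRow (row (2 N.+ x)) (row (3 N.+ (2 N.+ x)))
    go _ refl = nearLast3
  nearRegLast (suc (suc (suc (suc d)))) x (s≤s (s≤s (s≤s ()))) xl eq

  gram-near : ∀ d j → d ≤ 3 → d N.+ j < nn → traceθ (gramTerms j (d N.+ j)) ≡ dotRow (row j) (row (d N.+ j))
  gram-near d j d≤3 kl with rowKind j (NP.≤-<-trans (NP.m≤n+m j d) kl)
  ... | v0 = subst (λ k → traceθ (gramTerms 0 k) ≡ dotRow (row 0) (row k)) (sym (NP.+-identityʳ d)) (near0 d d≤3)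
  ... | v1 = subst (λ k → traceθ (gramTerms 1 k) ≡ dotRow (row 1) (row k)) (NP.+-comm 1 d) (near1 d d≤3)
  ... | vblock x xl with (d N.+ (2 N.+ x)) N.≟ (7 N.+ n8)
  ...   | no ne = nearReg d x d≤3 xl kl ne
  ...   | yes eq = nearRegLast d x d≤3 xl eq
  gram-near zero j d≤3 kl | vlast = lastlast
  gram-near (suc d) j d≤3 kl | vlast = ⊥-elim (NP.<⇒≱ kl (s≤s (NP.m≤n+m (7 N.+ n8) d)))

  gram-le : ∀ j k → j ≤ k → k < nn → traceθ (gramTerms j k) ≡ dotRow (row j) (row k)
  gram-le j k le kl with (k ∸ j) N.≤? 3
  ... | yes d≤3 =
    subst (λ t → traceθ (gramTerms j t) ≡ dotRow (row j) (row t)) ek (gram-near (k ∸ j) j d≤3 (subst (_< nn) (sym ek) kl))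
    where
    ek : k ∸ j N.+ j ≡ k
    ek = NP.m∸n+n≡m le
  ... | no nd =
    gram-far j k (subst (4 N.+ j ≤_) (NP.m∸n+n≡m le) (NP.+-monoˡ-≤ j (NP.≰⇒> nd))) kl

  gram : ∀ j k → j < nn → k < nn → traceθ (gramTerms j k) ≡ dotRow (row j) (row k)
  gram j k jl kl with NP.≤-total j k
  ... | inj₁ le = gram-le j k le kl
  ... | inj₂ kj = trans (gram-sym j k) (trans (gram-le k j kj jl) (dotRow-sym (row k) (row j)))

  fF : Fin (2 ^ q) → Fin (2 ^ q) → ℤ
  fF j i = Dn.basisVec (toℕ j) (toℕ i)

  fF-basis : IsBasisD (2 ^ q) fF
  fF-basis = subst (λ m → IsBasisD m (λ j i → Dn.basisVec (toℕ j) (toℕ i))) (sym hn) Dn.rows-basisD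

  toℕ<nn : (j : Fin (2 ^ q)) → toℕ j < nn
  toℕ<nn j = subst (toℕ j <_) hn (toℕ<n j)

  dot-fF : ∀ (j k : Fin (2 ^ q)) → dot (2 ^ q) (fF j) (fF k) ≡ dotRow (row (toℕ j)) (row (toℕ k))
  dot-fF j k =
    trans (sumF≡sumN (2 ^ q) _ (λ i → Dn.basisVec (toℕ j) i Z.* Dn.basisVec (toℕ k) i) (λ _ → refl))
      (trans (cong (λ m → sumN m (λ i → Dn.basisVec (toℕ j) i Z.* Dn.basisVec (toℕ k) i)) hn)
        (Dn.dot-evalRow (row (toℕ j)) (row (toℕ k)) (Dn.rowPositions (toℕ j) (toℕ<nn j))))

  gram-twInner : (j k : Fin (2 ^ q)) (m : Fin (2 ^ suc q)) →
      twInner r (basisO r j) (basisO r k) m ≡ ((+ (2 ^ suc q)) Z.* dot (2 ^ q) (fF j) (fF k)) Z.* one r m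
  gram-twInner j k m =
    trans (twInner-basis j k m)
      (cong (λ z → (+ (2 ^ suc q) Z.* z) Z.* one r m)
        (trans (gram (toℕ j) (toℕ k) (toℕ<nn j) (toℕ<nn k)) (sym (dot-fF j k))))

proposition5 : (r : ℕ) → 5 ≤ r → RotatedD r
proposition5 (suc (suc q)) (s≤s (s≤s 3≤q)) = fF , fF-basis , gram-twInner
  where
  n8 : ℕ
  n8 = 2 ^ q ∸ 8

  n≡8+n8 : 2 ^ q ≡ 8 N.+ n8
  n≡8+n8 = sym (NP.m+[n∸m]≡n (NP.^-monoʳ-≤ 2 3≤q))

  open GramMatch q n8 n≡8+n8
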